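{- For every integer $n \ge 6$, the doubly metric dimension of the Kneser graph $K_{n,2}$ is $\psi(K_{n,2}) = \lceil 2n/3 \rceil$.
   Context: The Kneser graph $K_{n,2}$ has as vertices all $2$-element subsets of $[n]=\{1,\dots,n\}$, two being adjacent iff they are disjoint; $d$ denotes shortest-path distance. Vertices $x,y$ doubly resolve vertices $u,v$ if $d(u,x)-d(u,y)\ne d(v,x)-d(v,y)$. A vertex set $D$ is a doubly resolving set if every two distinct vertices are doubly resolved by some two vertices of $D$; $\psi(G)$ is the minimum cardinality of a doubly resolving set of $G$. -}

module Defs where

open import Data.Nat using (ℕ; zero; suc; _+_; _*_; _∸_; _≤_; _<_; NonZero)
open import Data.Nat.DivMod using (_/_)
open import Data.Integer as ℤ using (ℤ)
open import Data.Fin using (Fin; toℕ)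
open import Data.Fin.Properties using () renaming (_≟_ to _≟ᶠ_)
open import Data.Nat.Properties using (_<?_)
open import Data.Bool using (Bool; true; false; not; _∧_; _∨_; if_then_else_)
open import Data.Bool.ListAction using (any)
open import Data.List using (List; []; _∷_; length; concatMap; mapMaybe; map)
open import Data.List.Membership.Propositional using (_∈_)
open import Data.List.Relation.Unary.Unique.Propositional using (Unique)
open import Data.Maybe using (Maybe; just; nothing)
open import Data.Product using (Σ; _×_; _,_; ∃; proj₁; proj₂)
import Data.Empty
open import Data.Empty using (⊥)
open import Relation.Nullary using (¬_; Dec; yes; no; does)
open import Relation.Binary.PropositionalEquality using (_≡_; _≢_)
open import Data.List using (allFin; [_])
open import Data.List.Relation.Unary.Any as Any using (here)
open import Data.List.Membership.Propositional.Properties using (∈-concatMap⁺; ∈-allFin)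
open import Data.Nat.Properties using (≤-irrelevant)
open import Data.Product.Properties using (≡-dec)
open import Relation.Binary.PropositionalEquality using (refl)

record FinGraph : Set₁ where
  field
    V        : Set
    _≟V_     : (u v : V) → Dec (u ≡ v)
    vertices : List V
    complete : (v : V) → v ∈ vertices
    adj      : V → V → Bool

module _ (G : FinGraph) where
  open FinGraph G

  reachWithin : ℕ → V → V → Bool
  reachWithin zero    u v = does (u ≟V v)
  reachWithin (suc k) u v =
    reachWithin k u v ∨ any (λ w → reachWithin k u w ∧ adj w v) vertices

  -- least k < b with p k, and b if there is none
  leastBelow : (ℕ → Bool) → ℕ → ℕ
  leastBelow p zero    = zero
  leastBelow p (suc b) = if p zero then zero else suc (leastBelow (λ k → p (suc k)) b)

  -- shortest-path distance (a shortest walk has length < |V|;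
  -- value |V| would signal "unreachable", which never occurs in connected graphs)
  dist : V → V → ℕ
  dist u v = leastBelow (λ k → reachWithin k u v) (length vertices)

  DoublyResolve : V → V → V → V → Set
  DoublyResolve x y u v =
    (ℤ.+ dist u x ℤ.- ℤ.+ dist u y) ≢ (ℤ.+ dist v x ℤ.- ℤ.+ dist v y)

  IsDoublyResolving : List V → Set
  IsDoublyResolving D =
    (u v : V) → u ≢ v →
    Σ V λ x → Σ V λ y → x ∈ D × y ∈ D × DoublyResolve x y u v

  DoublyMetricDimensionIs : ℕ → Set
  DoublyMetricDimensionIs m =
    (Σ (List V) λ D → Unique D × IsDoublyResolving D × length D ≡ m)
    × ((D : List V) → Unique D → IsDoublyResolving D → m ≤ length D)

-- Kneser graph K(n,2): vertices are 2-subsets {i,j} of Fin n, written i < j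

Pair : ℕ → Set
Pair n = Σ (Fin n) λ i → Σ (Fin n) λ j → toℕ i < toℕ j


pairIf : ∀ {n} (i j : Fin n) → List (Pair n)
pairIf i j with toℕ i <? toℕ j
... | yes p = [ (i , j , p) ]
... | no _  = []

pairs : (n : ℕ) → List (Pair n)
pairs n = concatMap (λ i → concatMap (λ j → pairIf i j) (allFin n)) (allFin n)

private
  pairIf-∈ : ∀ {n} (i j : Fin n) (p : toℕ i < toℕ j) → (i , j , p) ∈ pairIf i j
  pairIf-∈ i j p with toℕ i <? toℕ j
  ... | yes q rewrite ≤-irrelevant p q = here refl
  ... | no ¬q = Data.Empty.⊥-elim (¬q p)

pairs-complete : ∀ {n} (v : Pair n) → v ∈ pairs n
pairs-complete {n} (i , j , p) =
  ∈-concatMap⁺ (λ i′ → concatMap (λ j′ → pairIf i′ j′) (allFin n)) (Any.map (λ { refl →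
    ∈-concatMap⁺ (λ j′ → pairIf i j′) (Any.map (λ { refl → pairIf-∈ i j p }) (∈-allFin j)) }) (∈-allFin i))

_≟P_ : ∀ {n} (u v : Pair n) → Dec (u ≡ v)
_≟P_ = ≡-dec _≟ᶠ_ (≡-dec _≟ᶠ_ (λ p q → yes (≤-irrelevant p q)))

disjoint : ∀ {n} → Pair n → Pair n → Bool
disjoint (i , j , _) (k , l , _) =
  not (does (i ≟ᶠ k)) ∧ not (does (i ≟ᶠ l)) ∧ not (does (j ≟ᶠ k)) ∧ not (does (j ≟ᶠ l))

Kneser2 : ℕ → FinGraph
Kneser2 n = record
  { V = Pair n ; _≟V_ = _≟P_ ; vertices = pairs n
  ; complete = pairs-complete ; adj = disjoint }

⌈_/_⌉ : ℕ → (b : ℕ) → .{{NonZero b}} → ℕ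
⌈ a / b ⌉ = (a + (b ∸ 1)) / b

module Submission where

-- Distances in K(n,2) only take the values 0, 1 (disjoint) and 2 (meeting, for n ≥ 5), so x, y
-- doubly resolve u, v exactly when δ u v = d(u,·) − d(v,·) differs at x and y.  Read a vertex set
-- D as a graph on [n].
-- Upper bound: if D is a spanning forest of stars in which every centre has at least two leaves,
-- then every pair u ≠ v is resolved by two edges of D with different δ.  Taking the centres
-- 0, …, k − 1 with k = ⌊n/3⌋ and hanging every other vertex i on i mod k uses n − ⌊n/3⌋ = ⌈2n/3⌉
-- edges.
-- Lower bound: no two vertices b, c can be met by exactly the same edges of D, since {a,b} and
-- {a,c} would then be equidistant from all of D.  So at most one vertex is isolated and no edge
-- joins two leaves; if some z is isolated, no vertex of degree 2 has two leaf neighbours either.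
-- Counting leaves twice gives 2n + Σ (deg − 2)⁺ + #inner edges = 3|D| + 2·#isolated, and with an
-- isolated vertex and n ≥ 6 the left-hand side always has two spare units.

open import Defs
open import Data.Bool using (T; true; false)
open import Data.Bool.Properties using (T-∨; T-∧)
open import Data.Empty using (⊥; ⊥-elim)
open import Data.Fin using (Fin; toℕ; fromℕ<)
open import Data.Fin.Properties using (toℕ-injective; toℕ-fromℕ<; toℕ<n; injective⇒≤; ¬∀⟶∃¬; any?)
  renaming (_≟_ to _≟ᶠ_)
open import Data.Integer as ℤ using (ℤ; _⊖_)
import Data.Integer.Properties as ℤ
import Data.Integer.Tactic.RingSolver as ℤ
open import Data.List using (List; []; _∷_; length; lookup; map; filter; allFin; _++_)
open import Data.List.Properties using (length-map; length-++; length-tabulate)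
open import Data.List.Membership.Propositional using (_∈_; _∉_)
open import Data.List.Membership.Propositional.Properties
  using (∈-filter⁺; ∈-filter⁻; ∈-map⁺; ∈-length; ∈-allFin; ∈-++⁺ˡ; ∈-++⁺ʳ)
open import Data.List.Relation.Unary.Any as Any using (here; there)
open import Data.List.Relation.Unary.Any.Properties using (any⁺; any⁻; lookup-index)
open import Data.List.Relation.Unary.All using ([]; _∷_)
open import Data.List.Relation.Unary.AllPairs using ([]; _∷_)
open import Data.List.Relation.Unary.Unique.Propositional using (Unique)
open import Data.List.Relation.Unary.Unique.Propositional.Properties
  using (Unique[x∷xs]⇒x∉xs; filter⁺; map⁺; allFin⁺)
open import Data.Nat using (ℕ; zero; suc; _+_; _*_; _∸_; _≤_; _<_; z≤n; s≤s; _≟_; _≤?_; NonZero; >-nonZero)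
open import Data.Nat.DivMod
  using (_/_; _%_; m%n<n; m≡m%n+[m/n]*n; m*n/n≡m; m/n*n≤m; /-monoˡ-≤; +-distrib-/-∣ʳ; m<n⇒m/n≡0;
         m%n%n≡m%n; [m+kn]%n≡m%n; m<n⇒m%n≡m)
open import Data.Nat.Divisibility using (divides-refl)
open import Data.Nat.ListAction using (sum)
open import Data.Nat.Properties
open import Data.Nat.Tactic.RingSolver using (solve-∀)
open import Data.Product using (Σ; ∃; ∃-syntax; ∃₂; _×_; _,_; proj₁; proj₂; swap)
open import Data.Sum using (_⊎_; inj₁; inj₂; [_,_]′)
open import Data.Unit using (tt)
open import Data.Vec using (Vec; []; _∷_)
open import Data.Vec.Relation.Unary.All using ([]; _∷_)
open import Data.Vec.Relation.Unary.AllPairs using ([]; _∷_)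
import Data.Vec.Relation.Unary.Unique.Propositional as Vec
open import Data.Vec.Relation.Unary.Unique.Propositional.Properties using (lookup-injective)
open import Function using (_∘_; id; Equivalence)
open import Relation.Binary using (tri<; tri≈; tri>)
open import Relation.Binary.Definitions using (DecidableEquality)
open import Relation.Binary.PropositionalEquality
  using (_≡_; _≢_; refl; sym; trans; cong; cong₂; subst; subst₂; module ≡-Reasoning)
open import Relation.Nullary using (¬_; Dec; yes; no; ¬?)
open import Relation.Nullary.Decidable using (_×-dec_)

open Equivalence using (to; from)

private variable
  A : Set

𝟙 : {P : Set} → Dec P → ℕ
𝟙 (yes _) = 1
𝟙 (no _)  = 0

∑ : List A → (A → ℕ) → ℕ
∑ xs f = sum (map f xs)

syntax ∑ xs (λ x → e) = ∑[ x ∈ xs ] e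

∑-cong : ∀ (xs : List A) {f g} → (∀ {x} → x ∈ xs → f x ≡ g x) → ∑ xs f ≡ ∑ xs g
∑-cong []       f≡g = refl
∑-cong (x ∷ xs) f≡g = cong₂ _+_ (f≡g (here refl)) (∑-cong xs (λ p → f≡g (there p)))

∑-+ : ∀ (xs : List A) f g → ∑[ x ∈ xs ] (f x + g x) ≡ ∑ xs f + ∑ xs g
∑-+ []       f g = refl
∑-+ (x ∷ xs) f g = trans (cong ((f x + g x) +_) (∑-+ xs f g)) (interchange (f x) (g x) _ _)
  where
  interchange : ∀ a b c d → a + b + (c + d) ≡ a + c + (b + d)
  interchange = solve-∀

∑-const : ∀ (xs : List A) k → ∑[ x ∈ xs ] k ≡ k * length xs
∑-const []       k = sym (*-zeroʳ k)
∑-const (x ∷ xs) k = trans (cong (k +_) (∑-const xs k)) (sym (*-suc k (length xs)))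

∑-*ˡ : ∀ (xs : List A) k f → ∑[ x ∈ xs ] (k * f x) ≡ k * ∑ xs f
∑-*ˡ []       k f = sym (*-zeroʳ k)
∑-*ˡ (x ∷ xs) k f = trans (cong ((k * f x) +_) (∑-*ˡ xs k f)) (sym (*-distribˡ-+ k (f x) (∑ xs f)))

∈⇒≤∑ : ∀ {xs : List A} f {x} → x ∈ xs → f x ≤ ∑ xs f
∈⇒≤∑ f (here refl)       = m≤m+n _ _
∈⇒≤∑ {xs = y ∷ _} f (there p) = ≤-trans (∈⇒≤∑ f p) (m≤n+m _ (f y))

∈-∈-≢⇒+≤∑ : ∀ {xs : List A} f {x y} → x ∈ xs → y ∈ xs → x ≢ y → f x + f y ≤ ∑ xs f
∈-∈-≢⇒+≤∑ f (here refl) (here refl) x≢y = ⊥-elim (x≢y refl)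
∈-∈-≢⇒+≤∑ f (here refl) (there q)   _   = +-monoʳ-≤ _ (∈⇒≤∑ f q)
∈-∈-≢⇒+≤∑ {xs = z ∷ _} f {x} (there p) (here refl) _ =
  ≤-trans (≤-reflexive (+-comm (f x) (f z))) (+-monoʳ-≤ (f z) (∈⇒≤∑ f p))
∈-∈-≢⇒+≤∑ {xs = z ∷ _} f (there p) (there q) x≢y =
  ≤-trans (∈-∈-≢⇒+≤∑ f p q x≢y) (m≤n+m _ (f z))

∑-𝟙≡-∉ : ∀ {xs : List A} (_≟_ : DecidableEquality A) {a} (f : A → ℕ) → a ∉ xs →
         ∑[ x ∈ xs ] (𝟙 (x ≟ a) * f x) ≡ 0
∑-𝟙≡-∉ {xs = []}     _≟_     f a∉xs = refl
∑-𝟙≡-∉ {xs = x ∷ xs} _≟_ {a} f a∉xs with x ≟ a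
... | yes refl = ⊥-elim (a∉xs (here refl))
... | no _     = ∑-𝟙≡-∉ _≟_ f (λ p → a∉xs (there p))

∑-𝟙≡ : ∀ {xs : List A} (_≟_ : DecidableEquality A) {a} (f : A → ℕ) → Unique xs → a ∈ xs →
       ∑[ x ∈ xs ] (𝟙 (x ≟ a) * f x) ≡ f a
∑-𝟙≡ {xs = x ∷ xs} _≟_ {a} f u@(_ ∷ u′) a∈ with x ≟ a | a∈
... | yes refl | _         =
  trans (cong ((1 * f x) +_) (∑-𝟙≡-∉ _≟_ f (Unique[x∷xs]⇒x∉xs u)))
        (trans (+-identityʳ (1 * f x)) (*-identityˡ (f x)))
... | no x≢a  | here a≡x  = ⊥-elim (x≢a (sym a≡x))
... | no _    | there a∈′ = ∑-𝟙≡ _≟_ f u′ a∈′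

injection⇒≤length : ∀ {k} {xs : List A} (f : Fin k → A) → (∀ {i j} → f i ≡ f j → i ≡ j) →
                    (∀ i → f i ∈ xs) → k ≤ length xs
injection⇒≤length {xs = xs} f f-inj f∈xs = injective⇒≤ index-inj
  where
  index-inj : ∀ {i j} → Any.index (f∈xs i) ≡ Any.index (f∈xs j) → i ≡ j
  index-inj {i} {j} eq = f-inj (begin
    f i                              ≡⟨ lookup-index (f∈xs i) ⟩
    lookup xs (Any.index (f∈xs i))   ≡⟨ cong (lookup xs) eq ⟩
    lookup xs (Any.index (f∈xs j))   ≡⟨ lookup-index (f∈xs j) ⟨
    f j                              ∎)
    where open ≡-Reasoning

fresh : ∀ {n} (xs : List (Fin n)) → length xs < n → ∃[ t ] t ∉ xs
fresh {n} xs xs<n = ¬∀⟶∃¬ n (_∈ xs) (λ t → Any.any? (t ≟ᶠ_) xs) ¬all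
  where
  ¬all : ¬ (∀ t → t ∈ xs)
  ¬all all∈ = <⇒≱ xs<n (injection⇒≤length id id all∈)

nonempty⇒∈ : ∀ {xs : List A} → 0 < length xs → ∃[ x ] x ∈ xs
nonempty⇒∈ {xs = x ∷ _} _ = x , here refl

length≡1⇒≡ : ∀ {xs : List A} {x y} → length xs ≡ 1 → x ∈ xs → y ∈ xs → x ≡ y
length≡1⇒≡ {xs = _ ∷ []} _ (here refl) (here refl) = refl

length≡2⇒ : ∀ {xs : List A} → length xs ≡ 2 → Unique xs →
            ∃₂ λ a b → a ≢ b × a ∈ xs × b ∈ xs × (∀ {x} → x ∈ xs → x ≡ a ⊎ x ≡ b)
length≡2⇒ {xs = a ∷ b ∷ []} _ ((a≢b ∷ []) ∷ _) = a , b , a≢b , here refl , there (here refl) , only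
  where
  only : ∀ {x} → x ∈ a ∷ b ∷ [] → x ≡ a ⊎ x ≡ b
  only (here x≡a)         = inj₁ x≡a
  only (there (here x≡b)) = inj₂ x≡b

𝟙-accept : ∀ {P : Set} (p : Dec P) → P → 𝟙 p ≡ 1
𝟙-accept (yes _) _  = refl
𝟙-accept (no ¬p) p = ⊥-elim (¬p p)

𝟙-reject : ∀ {P : Set} (p : Dec P) → ¬ P → 𝟙 p ≡ 0
𝟙-reject (yes p) ¬p = ⊥-elim (¬p p)
𝟙-reject (no _)  _  = refl

𝟙-cong : ∀ {P Q : Set} (p : Dec P) (q : Dec Q) → (P → Q) → (Q → P) → 𝟙 p ≡ 𝟙 q
𝟙-cong (yes _) (yes _) _   _   = refl
𝟙-cong (yes p) (no ¬q) p⇒q _   = ⊥-elim (¬q (p⇒q p))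
𝟙-cong (no ¬p) (yes q) _   q⇒p = ⊥-elim (¬p (q⇒p q))
𝟙-cong (no _)  (no _)  _   _   = refl

infix 4 _∈ₚ_

data _∈ₚ_ {n : ℕ} (t : Fin n) : Pair n → Set where
  first  : ∀ {b t<b} → t ∈ₚ (t , b , t<b)
  second : ∀ {a a<t} → t ∈ₚ (a , t , a<t)

module _ {n : ℕ} where

  private variable
    s t a b : Fin n
    x y u v : Pair n

  infix 4 _∈ₚ?_

  _∈ₚ?_ : (t : Fin n) (x : Pair n) → Dec (t ∈ₚ x)
  t ∈ₚ? (a , b , _) with t ≟ᶠ a | t ≟ᶠ b
  ... | yes refl | _        = yes first
  ... | no _     | yes refl = yes second
  ... | no t≢a   | no t≢b   = no λ { first → t≢a refl ; second → t≢b refl }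

  Meets : Pair n → Pair n → Set
  Meets u v = ∃[ t ] t ∈ₚ u × t ∈ₚ v

  fst snd : Pair n → Fin n
  fst (a , _ , _) = a
  snd (_ , b , _) = b

  fst∈ₚ : ∀ x → fst x ∈ₚ x
  fst∈ₚ _ = first

  snd∈ₚ : ∀ x → snd x ∈ₚ x
  snd∈ₚ _ = second

  meets-refl : ∀ x → Meets x x
  meets-refl x = fst x , first , first

  meets-sym : Meets u v → Meets v u
  meets-sym (t , t∈u , t∈v) = t , t∈v , t∈u

  ∈ₚ-ext : s ≢ t → s ∈ₚ x → t ∈ₚ x → s ∈ₚ y → t ∈ₚ y → x ≡ y
  ∈ₚ-ext s≢t first  first  _      _      = ⊥-elim (s≢t refl)
  ∈ₚ-ext s≢t second second _      _      = ⊥-elim (s≢t refl)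
  ∈ₚ-ext s≢t _      _      first  first  = ⊥-elim (s≢t refl)
  ∈ₚ-ext s≢t _      _      second second = ⊥-elim (s≢t refl)
  ∈ₚ-ext {y = _ , _ , q} _ (first {t<b = p}) second first second = cong (λ r → _ , _ , r) (<-irrelevant p q)
  ∈ₚ-ext {y = _ , _ , q} _ (second {a<t = p}) first second first = cong (λ r → _ , _ , r) (<-irrelevant p q)
  ∈ₚ-ext {y = _ , _ , q} _ (first {t<b = p}) second second first = ⊥-elim (<-asym p q)
  ∈ₚ-ext {y = _ , _ , q} _ (second {a<t = p}) first first second = ⊥-elim (<-asym p q)

  pair : (a b : Fin n) → a ≢ b → Pair n
  pair a b a≢b with <-cmp (toℕ a) (toℕ b)
  ... | tri< a<b _ _ = a , b , a<b
  ... | tri≈ _ a≡b _ = ⊥-elim (a≢b (toℕ-injective a≡b))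
  ... | tri> _ _ b<a = b , a , b<a

  ∈ₚ-pair⁻ : (a≢b : a ≢ b) → t ∈ₚ pair a b a≢b → t ≡ a ⊎ t ≡ b
  ∈ₚ-pair⁻ {a} {b} a≢b t∈ with <-cmp (toℕ a) (toℕ b) | t∈
  ... | tri< _ _ _   | first  = inj₁ refl
  ... | tri< _ _ _   | second = inj₂ refl
  ... | tri≈ _ a≡b _ | _      = ⊥-elim (a≢b (toℕ-injective a≡b))
  ... | tri> _ _ _   | first  = inj₂ refl
  ... | tri> _ _ _   | second = inj₁ refl

  ∈ₚ-pairˡ : (a≢b : a ≢ b) → a ∈ₚ pair a b a≢b
  ∈ₚ-pairˡ {a} {b} a≢b with <-cmp (toℕ a) (toℕ b)
  ... | tri< _ _ _   = first
  ... | tri≈ _ a≡b _ = ⊥-elim (a≢b (toℕ-injective a≡b))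
  ... | tri> _ _ _   = second

  ∈ₚ-pairʳ : (a≢b : a ≢ b) → b ∈ₚ pair a b a≢b
  ∈ₚ-pairʳ {a} {b} a≢b with <-cmp (toℕ a) (toℕ b)
  ... | tri< _ _ _   = second
  ... | tri≈ _ a≡b _ = ⊥-elim (a≢b (toℕ-injective a≡b))
  ... | tri> _ _ _   = first

  other : Pair n → Fin n → Fin n
  other (a , b , _) t with t ≟ᶠ a
  ... | yes _ = b
  ... | no  _ = a

  other-∈ₚ : ∀ x t → other x t ∈ₚ x
  other-∈ₚ (a , b , _) t with t ≟ᶠ a
  ... | yes _ = second
  ... | no  _ = first

  other-≢ : t ∈ₚ x → other x t ≢ t
  other-≢ {t} (first {t<b = t<b}) with t ≟ᶠ t
  ... | yes _   = λ b≡t → <⇒≢ t<b (cong toℕ (sym b≡t))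
  ... | no  t≢t = ⊥-elim (t≢t refl)
  other-≢ {t} (second {a} {a<t}) with t ≟ᶠ a
  ... | yes refl = ⊥-elim (<-irrefl refl a<t)
  ... | no  _    = λ a≡t → <⇒≢ a<t (cong toℕ a≡t)

  ∈ₚ-other : t ∈ₚ x → s ∈ₚ x → s ≡ t ⊎ s ≡ other x t
  ∈ₚ-other first first = inj₁ refl
  ∈ₚ-other {t} first second with t ≟ᶠ t
  ... | yes _   = inj₂ refl
  ... | no  t≢t = ⊥-elim (t≢t refl)
  ∈ₚ-other {t} (second {a} {a<t}) first with t ≟ᶠ a
  ... | yes refl = ⊥-elim (<-irrefl refl a<t)
  ... | no  _    = inj₂ refl
  ∈ₚ-other second second = inj₁ refl

  disjoint⁺ : ¬ Meets u v → T (disjoint u v)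
  disjoint⁺ {i , j , _} {k , l , _} ¬meet with i ≟ᶠ k | i ≟ᶠ l | j ≟ᶠ k | j ≟ᶠ l
  ... | yes refl | _        | _        | _        = ¬meet (i , first , first)
  ... | no _     | yes refl | _        | _        = ¬meet (i , first , second)
  ... | no _     | no _     | yes refl | _        = ¬meet (j , second , first)
  ... | no _     | no _     | no _     | yes refl = ¬meet (j , second , second)
  ... | no _     | no _     | no _     | no _     = _

  disjoint⁻ : T (disjoint u v) → ¬ Meets u v
  disjoint⁻ {i , j , _} {k , l , _} disj (t , t∈u , t∈v)
    with i ≟ᶠ k | i ≟ᶠ l | j ≟ᶠ k | j ≟ᶠ l | t∈u | t∈v
  ... | no i≢k | _      | _      | _      | first  | first  = i≢k refl
  ... | _      | no i≢l | _      | _      | first  | second = i≢l refl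
  ... | _      | _      | no j≢k | _      | second | first  = j≢k refl
  ... | _      | _      | _      | no j≢l | second | second = j≢l refl
  ... | yes _  | _      | _      | _      | _      | _      = disj
  ... | no _   | yes _  | _      | _      | _      | _      = disj
  ... | no _   | no _   | yes _  | _      | _      | _      = disj
  ... | no _   | no _   | no _   | yes _  | _      | _      = disj

  meets? : ∀ u v → Dec (Meets u v)
  meets? (a , b , _) v with a ∈ₚ? v | b ∈ₚ? v
  ... | yes a∈v | _       = yes (a , first , a∈v)
  ... | no _    | yes b∈v = yes (b , second , b∈v)
  ... | no a∉v  | no b∉v  = no λ { (_ , first , a∈v) → a∉v a∈v ; (_ , second , b∈v) → b∉v b∈v }

  ∈ₚ-two : s ≢ t → s ∈ₚ x → t ∈ₚ x → a ∈ₚ x → a ≡ s ⊎ a ≡ t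
  ∈ₚ-two s≢t s∈x t∈x a∈x with ∈ₚ-other s∈x a∈x | ∈ₚ-other s∈x t∈x
  ... | inj₁ a≡s | _        = inj₁ a≡s
  ... | inj₂ _   | inj₁ t≡s = ⊥-elim (s≢t (sym t≡s))
  ... | inj₂ a≡o | inj₂ t≡o = inj₂ (trans a≡o (sym t≡o))

  other-≢-other : u ≢ v → a ∈ₚ u → a ∈ₚ v → other u a ≢ other v a
  other-≢-other {u} {v} {a} u≢v a∈u a∈v b≡c =
    u≢v (∈ₚ-ext (other-≢ a∈u ∘ sym) a∈u (other-∈ₚ u a) a∈v
                (subst (_∈ₚ v) (sym b≡c) (other-∈ₚ v a)))

  other-∉ : u ≢ v → a ∈ₚ u → a ∈ₚ v → ¬ other v a ∈ₚ u
  other-∉ u≢v a∈u a∈v c∈u with ∈ₚ-other a∈u c∈u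
  ... | inj₁ c≡a = other-≢ a∈v c≡a
  ... | inj₂ c≡b = other-≢-other u≢v a∈u a∈v (sym c≡b)

  fst≢snd : ∀ x → fst x ≢ snd x
  fst≢snd (_ , _ , a<b) a≡b = <⇒≢ a<b (cong toℕ a≡b)

  ¬meets-pair : (a≢b : a ≢ b) → ¬ a ∈ₚ x → ¬ b ∈ₚ x → ¬ Meets (pair a b a≢b) x
  ¬meets-pair a≢b a∉x b∉x (s , s∈p , s∈x) =
    [ (λ { refl → a∉x s∈x }) , (λ { refl → b∉x s∈x }) ]′ (∈ₚ-pair⁻ a≢b s∈p)

-- Distances

module _ (G : FinGraph) where
  open FinGraph G

  leastBelow-≡ : ∀ p {b k} → k < b → T (p k) → (∀ {j} → j < k → ¬ T (p j)) → leastBelow G p b ≡ k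
  leastBelow-≡ p {suc b} {zero} _ pk _ with p 0
  ... | true  = refl
  ... | false = ⊥-elim pk
  leastBelow-≡ p {suc b} {suc k} (s≤s k<b) pk below with p 0 | below {0} (s≤s z≤n)
  ... | true  | ¬p0 = ⊥-elim (¬p0 tt)
  ... | false | _   = cong suc (leastBelow-≡ (λ j → p (suc j)) k<b pk (λ j<k → below (s≤s j<k)))

  reachWithin-zero : ∀ {u v} → T (reachWithin G 0 u v) → u ≡ v
  reachWithin-zero {u} {v} r with u ≟V v
  ... | yes u≡v = u≡v
  ... | no  _   = ⊥-elim r

  reachWithin-refl : ∀ u → T (reachWithin G 0 u u)
  reachWithin-refl u with u ≟V u
  ... | yes _   = tt
  ... | no  u≢u = u≢u refl

  reachWithin-one : ∀ {u v} → T (reachWithin G 1 u v) → u ≡ v ⊎ T (adj u v)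
  reachWithin-one r with to T-∨ r
  ... | inj₁ u≡v  = inj₁ (reachWithin-zero u≡v)
  ... | inj₂ step with Any.satisfied (any⁻ _ vertices step)
  ...   | w , uw∧wv with to T-∧ uw∧wv
  ...     | u≡w , adj-wv rewrite reachWithin-zero u≡w = inj₂ adj-wv

  reachWithin-suc : ∀ {k u w v} → T (reachWithin G k u w) → T (adj w v) → T (reachWithin G (suc k) u v)
  reachWithin-suc {w = w} r a =
    from T-∨ (inj₂ (any⁺ _ (Any.map (λ { refl → from T-∧ (r , a) }) (complete w))))

  -- dist only searches for walks shorter than the number of listed vertices, so establishing a
  -- distance k needs k + 1 distinct vertices.
  distinct⇒≤#vertices : ∀ {k} {vs : Vec V k} → Vec.Unique vs → k ≤ length vertices
  distinct⇒≤#vertices distinct = injection⇒≤length _ (lookup-injective distinct _ _) (λ _ → complete _)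

  dist-refl : ∀ u → dist G u u ≡ 0
  dist-refl u = leastBelow-≡ _ (distinct⇒≤#vertices {vs = u ∷ []} ([] ∷ [])) (reachWithin-refl u) (λ ())

  dist-adjacent : ∀ {u v} → u ≢ v → T (adj u v) → dist G u v ≡ 1
  dist-adjacent {u} {v} u≢v a =
    leastBelow-≡ _ (distinct⇒≤#vertices {vs = u ∷ v ∷ []} ((u≢v ∷ []) ∷ [] ∷ []))
    (reachWithin-suc {0} (reachWithin-refl u) a) (λ { (s≤s z≤n) → u≢v ∘ reachWithin-zero })

  dist-two : ∀ {u v w} → u ≢ v → ¬ T (adj u v) → T (adj u w) → T (adj w v) → w ≢ u → w ≢ v →
             dist G u v ≡ 2
  dist-two {u} {v} {w} u≢v ¬uv uw wv w≢u w≢v =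
    leastBelow-≡ _ (distinct⇒≤#vertices {vs = u ∷ v ∷ w ∷ []} distinct)
      (reachWithin-suc {1} (reachWithin-suc {0} (reachWithin-refl u) uw) wv) not-closer
    where
    distinct : Vec.Unique (u ∷ v ∷ w ∷ [])
    distinct = (u≢v ∷ (w≢u ∘ sym) ∷ []) ∷ ((w≢v ∘ sym) ∷ []) ∷ [] ∷ []
    not-closer : ∀ {j} → j < 2 → ¬ T (reachWithin G j u v)
    not-closer (s≤s z≤n)       r = u≢v (reachWithin-zero r)
    not-closer (s≤s (s≤s z≤n)) r = [ u≢v , ¬uv ]′ (reachWithin-one r)

module _ {n : ℕ} where

  private variable
    u v : Pair n

  d : Pair n → Pair n → ℕ
  d = dist (Kneser2 n)

  d-refl : ∀ u → d u u ≡ 0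
  d-refl = dist-refl (Kneser2 n)

  d-disjoint : ¬ Meets u v → d u v ≡ 1
  d-disjoint {u} {v} ¬meet =
    dist-adjacent (Kneser2 n) (λ { refl → ¬meet (meets-refl u) }) (disjoint⁺ ¬meet)

  common-neighbour : 5 ≤ n → Meets u v → ∃[ w ] ¬ Meets u w × ¬ Meets w v
  common-neighbour {u} {v} 5≤n (t , t∈u , t∈v) =
    w , (λ (s , s∈u , s∈w) → off-w s∈w (in-u s∈u)) , (λ (s , s∈w , s∈v) → off-w s∈w (in-v s∈v))
    where
    avoid : List (Fin n)
    avoid = fst u ∷ snd u ∷ other v t ∷ []
    t₁ : Fin n
    t₁ = proj₁ (fresh avoid (≤-trans (s≤s (s≤s (s≤s (s≤s z≤n)))) 5≤n))
    t₁∉ : t₁ ∉ avoid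
    t₁∉ = proj₂ (fresh avoid (≤-trans (s≤s (s≤s (s≤s (s≤s z≤n)))) 5≤n))
    t₂ : Fin n
    t₂ = proj₁ (fresh (t₁ ∷ avoid) 5≤n)
    t₂∉ : t₂ ∉ t₁ ∷ avoid
    t₂∉ = proj₂ (fresh (t₁ ∷ avoid) 5≤n)
    in-u : ∀ {s} → s ∈ₚ u → s ∈ avoid
    in-u first  = here refl
    in-u second = there (here refl)
    in-v : ∀ {s} → s ∈ₚ v → s ∈ avoid
    in-v s∈v = [ (λ { refl → in-u t∈u }) , (λ s≡o → there (there (here s≡o))) ]′ (∈ₚ-other t∈v s∈v)
    t₁≢t₂ : t₁ ≢ t₂
    t₁≢t₂ t₁≡t₂ = t₂∉ (here (sym t₁≡t₂))
    w : Pair n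
    w = pair t₁ t₂ t₁≢t₂
    off-w : ∀ {s} → s ∈ₚ w → s ∉ avoid
    off-w s∈w = [ (λ { refl → t₁∉ }) , (λ { refl → t₂∉ ∘ there }) ]′ (∈ₚ-pair⁻ t₁≢t₂ s∈w)

  d-meets : 5 ≤ n → u ≢ v → Meets u v → d u v ≡ 2
  d-meets {u} {v} 5≤n u≢v meet with common-neighbour 5≤n meet
  ... | w , ¬uw , ¬wv = dist-two (Kneser2 n) {u} {v} {w} u≢v (λ disj → disjoint⁻ disj meet)
      (disjoint⁺ ¬uw) (disjoint⁺ ¬wv) (λ { refl → ¬uw (meets-refl w) }) (λ { refl → ¬wv (meets-refl w) })

module _ {n : ℕ} where

  private variable
    u v x y : Pair n

  Equidistant : List (Pair n) → Pair n → Pair n → Set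
  Equidistant D u v = ∀ {x} → x ∈ D → d u x ≡ d v x

  ¬equidistant : ∀ {D} → IsDoublyResolving (Kneser2 n) D → u ≢ v → ¬ Equidistant D u v
  ¬equidistant {u} {v} resolving u≢v equidistant with resolving u v u≢v
  ... | x , y , x∈D , y∈D , resolves =
    resolves (cong₂ (λ p q → ℤ.+ p ℤ.- ℤ.+ q) (equidistant x∈D) (equidistant y∈D))

  δ : Pair n → Pair n → Pair n → ℤ
  δ u v x = d u x ⊖ d v x

  δ-resolves : δ u v x ≢ δ u v y → DoublyResolve (Kneser2 n) x y u v
  δ-resolves {u} {v} {x} {y} δx≢δy eq = δx≢δy (begin
    d u x ⊖ d v x                          ≡⟨ ℤ.m-n≡m⊖n (d u x) (d v x) ⟨
    a ℤ.- b                                ≡⟨ regroup a b c e ⟩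
    (a ℤ.- c) ℤ.- (b ℤ.- e) ℤ.+ (c ℤ.- e)  ≡⟨ cong (ℤ._+ (c ℤ.- e)) (ℤ.i≡j⇒i-j≡0 eq) ⟩
    ℤ.0ℤ ℤ.+ (c ℤ.- e)                     ≡⟨ ℤ.+-identityˡ (c ℤ.- e) ⟩
    c ℤ.- e                                ≡⟨ ℤ.m-n≡m⊖n (d u y) (d v y) ⟩
    d u y ⊖ d v y                          ∎)
    where
    open ≡-Reasoning
    a b c e : ℤ
    a = ℤ.+ d u x
    b = ℤ.+ d v x
    c = ℤ.+ d u y
    e = ℤ.+ d v y
    regroup : ∀ a b c e → a ℤ.- b ≡ (a ℤ.- c) ℤ.- (b ℤ.- e) ℤ.+ (c ℤ.- e)
    regroup = ℤ.solve-∀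

  δ-swap : ∀ u v x → δ v u x ≡ ℤ.- δ u v x
  δ-swap u v x = ℤ.⊖-swap (d v x) (d u x)

  Separates : Pair n → Pair n → Pair n → Set
  Separates u v x = (Meets u x × ¬ Meets v x) ⊎ (¬ Meets u x × Meets v x)

  separates-sym : ∀ {u v x} → Separates u v x → Separates v u x
  separates-sym = [ inj₂ ∘ swap , inj₁ ∘ swap ]′

module _ {n : ℕ} (5≤n : 5 ≤ n) where

  private variable
    a : Fin n
    u v x : Pair n

  private
    δ≡ : ∀ {p q} → d u x ≡ p → d v x ≡ q → δ u v x ≡ p ⊖ q
    δ≡ = cong₂ _⊖_

  -- The possible values of δ u v x are written d u x ⊖ d v x.
  δ-meets-only-u : ¬ Meets v x → Meets u x → δ u v x ≡ 2 ⊖ 1 ⊎ δ u v x ≡ 0 ⊖ 1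
  δ-meets-only-u {v} {x} {u} ¬vx ux with u ≟P x
  ... | yes refl = inj₂ (δ≡ (d-refl u) (d-disjoint ¬vx))
  ... | no u≢x   = inj₁ (δ≡ (d-meets 5≤n u≢x ux) (d-disjoint ¬vx))

  δ-meets-only-v : ¬ Meets u x → Meets v x → δ u v x ≡ 1 ⊖ 0 ⊎ δ u v x ≡ 1 ⊖ 2
  δ-meets-only-v {u} {x} {v} ¬ux vx with δ-meets-only-u ¬ux vx
  ... | inj₁ e = inj₂ (trans (δ-swap v u x) (cong ℤ.-_ e))
  ... | inj₂ e = inj₁ (trans (δ-swap v u x) (cong ℤ.-_ e))

  δ-separates : Separates u v x → δ u v x ≡ ℤ.1ℤ ⊎ δ u v x ≡ ℤ.-1ℤ
  δ-separates (inj₁ (ux , ¬vx)) = δ-meets-only-u ¬vx ux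
  δ-separates (inj₂ (¬ux , vx)) = δ-meets-only-v ¬ux vx

  δ-near-v : ¬ Meets u v → v ≢ x → Meets v x → δ u v x ≡ 1 ⊖ 2 ⊎ δ u v x ≡ 2 ⊖ 2
  δ-near-v {u} {v} {x} ¬uv v≢x vx with meets? u x
  ... | yes ux = inj₂ (δ≡ (d-meets 5≤n u≢x ux) (d-meets 5≤n v≢x vx))
    where
    u≢x : u ≢ x
    u≢x refl = ¬uv (meets-sym vx)
  ... | no ¬ux = inj₁ (δ≡ (d-disjoint ¬ux) (d-meets 5≤n v≢x vx))

  δ-near-u : ¬ Meets u v → u ≢ x → Meets u x → δ u v x ≡ 2 ⊖ 2 ⊎ δ u v x ≡ 2 ⊖ 1
  δ-near-u {u} {v} {x} ¬uv u≢x ux with δ-near-v (¬uv ∘ meets-sym) u≢x ux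
  ... | inj₁ e = inj₂ (trans (δ-swap v u x) (cong ℤ.-_ e))
  ... | inj₂ e = inj₁ (trans (δ-swap v u x) (cong ℤ.-_ e))

  δ-shared-u : u ≢ v → a ∈ₚ u → a ∈ₚ v → other u a ∈ₚ x → ¬ other v a ∈ₚ x →
               δ u v x ≡ 2 ⊖ 1 ⊎ δ u v x ≡ 0 ⊖ 2
  δ-shared-u {u} {v} {a} {x} u≢v a∈u a∈v b∈x c∉x with u ≟P x
  ... | yes refl = inj₂ (δ≡ (d-refl u) (d-meets 5≤n (u≢v ∘ sym) (a , a∈v , a∈u)))
  ... | no u≢x   = inj₁ (δ≡ (d-meets 5≤n u≢x (other u a , other-∈ₚ u a , b∈x)) (d-disjoint ¬vx))
    where
    ¬vx : ¬ Meets v x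
    ¬vx (s , s∈v , s∈x) with ∈ₚ-other a∈v s∈v
    ... | inj₁ refl = u≢x (∈ₚ-ext (other-≢ a∈u ∘ sym) a∈u (other-∈ₚ u a) s∈x b∈x)
    ... | inj₂ refl = c∉x s∈x

  δ-shared-both : u ≢ v → a ∈ₚ u → a ∈ₚ v → other u a ∈ₚ x → other v a ∈ₚ x →
                  δ u v x ≡ 2 ⊖ 2
  δ-shared-both {u} {v} {a} {x} u≢v a∈u a∈v b∈x c∈x =
    δ≡ (d-meets 5≤n u≢x (other u a , other-∈ₚ u a , b∈x))
       (d-meets 5≤n v≢x (other v a , other-∈ₚ v a , c∈x))
    where
    u≢x : u ≢ x
    u≢x refl = other-∉ u≢v a∈u a∈v c∈x
    v≢x : v ≢ x
    v≢x refl = other-∉ (u≢v ∘ sym) a∈v a∈u b∈x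

  δ-shared-v : u ≢ v → a ∈ₚ u → a ∈ₚ v → other v a ∈ₚ x → ¬ other u a ∈ₚ x →
               δ u v x ≡ 1 ⊖ 2 ⊎ δ u v x ≡ 2 ⊖ 0
  δ-shared-v {u} {v} {a} {x} u≢v a∈u a∈v c∈x b∉x with δ-shared-u (u≢v ∘ sym) a∈v a∈u c∈x b∉x
  ... | inj₁ e = inj₁ (trans (δ-swap v u x) (cong ℤ.-_ e))
  ... | inj₂ e = inj₂ (trans (δ-swap v u x) (cong ℤ.-_ e))

-- Upper bound: star forests are doubly resolving

module _ {n : ℕ} where

  Resolved : List (Pair n) → Pair n → Pair n → Set
  Resolved D u v = Σ (Pair n) λ x → Σ (Pair n) λ y → x ∈ D × y ∈ D × DoublyResolve (Kneser2 n) x y u v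

  resolved : ∀ {D u v x y i j} → x ∈ D → y ∈ D → δ u v x ≡ i → δ u v y ≡ j → i ≢ j → Resolved D u v
  resolved {u = u} {v} {x} {y} x∈D y∈D δx≡i δy≡j i≢j =
    x , y , x∈D , y∈D ,
    δ-resolves {u = u} {v} {x} {y} (λ δx≡δy → i≢j (trans (sym δx≡i) (trans δx≡δy δy≡j)))

-- t is a centre iff centre t ≡ t; every other vertex ℓ is a leaf, joined in D to centre ℓ.
module StarForest {n : ℕ} (5≤n : 5 ≤ n)
  (centre : Fin n → Fin n)
  (centre-idem : ∀ t → centre (centre t) ≡ centre t)
  (two-leaves : ∀ c → centre c ≡ c →
    ∃₂ λ ℓ₁ ℓ₂ → ℓ₁ ≢ ℓ₂ × (centre ℓ₁ ≡ c × ℓ₁ ≢ c) × (centre ℓ₂ ≡ c × ℓ₂ ≢ c))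
  (D : List (Pair n))
  (joined : ∀ ℓ → centre ℓ ≢ ℓ → ∃[ x ] x ∈ D × centre ℓ ∈ₚ x × ℓ ∈ₚ x)
  where

  private variable
    c f q t ℓ : Fin n
    u v : Pair n

  LeafOf : Fin n → Fin n → Set
  LeafOf c ℓ = centre ℓ ≡ c × ℓ ≢ c

  EdgeBetween : Fin n → Fin n → Pair n → Set
  EdgeBetween c ℓ x = x ∈ D × c ∈ₚ x × ℓ ∈ₚ x × (∀ {s} → s ∈ₚ x → s ≡ c ⊎ s ≡ ℓ)

  Avoiding : Fin n → Fin n → Pair n → Set
  Avoiding t f x = x ∈ D × t ∈ₚ x × ¬ f ∈ₚ x

  leaf-edge : LeafOf c ℓ → ∃[ x ] EdgeBetween c ℓ x
  leaf-edge {ℓ = ℓ} (refl , ℓ≢c) with joined ℓ (ℓ≢c ∘ sym)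
  ... | x , x∈D , c∈x , ℓ∈x = x , x∈D , c∈x , ℓ∈x , ∈ₚ-two (ℓ≢c ∘ sym) c∈x ℓ∈x

  leaf-avoiding : centre c ≡ c → ∀ f → ∃[ ℓ ] LeafOf c ℓ × ℓ ≢ f
  leaf-avoiding {c} cc≡c f with two-leaves c cc≡c
  ... | ℓ₁ , ℓ₂ , ℓ₁≢ℓ₂ , leaf₁ , leaf₂ with ℓ₁ ≟ᶠ f
  ...   | yes refl = ℓ₂ , leaf₂ , ℓ₁≢ℓ₂ ∘ sym
  ...   | no ℓ₁≢f  = ℓ₁ , leaf₁ , ℓ₁≢f

  edge-avoiding : t ≢ f → centre t ≢ f → ∃[ x ] Avoiding t f x
  edge-avoiding {t} {f} t≢f ct≢f with centre t ≟ᶠ t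
  ... | no ct≢t with leaf-edge (refl , ct≢t ∘ sym)
  ...   | x , x∈D , _ , t∈x , only = x , x∈D , t∈x , [ ct≢f ∘ sym , t≢f ∘ sym ]′ ∘ only
  edge-avoiding {t} {f} t≢f ct≢f | yes ct≡t with leaf-avoiding ct≡t f
  ... | ℓ , leaf , ℓ≢f with leaf-edge leaf
  ...   | x , x∈D , t∈x , _ , only = x , x∈D , t∈x , [ t≢f ∘ sym , ℓ≢f ∘ sym ]′ ∘ only

  centre-not-leaf : LeafOf c (centre t) → ⊥
  centre-not-leaf {t = t} (cct≡c , ct≢c) = ct≢c (trans (sym (centre-idem t)) cct≡c)

  centre-fixed : centre t ≡ c → centre c ≡ c
  centre-fixed {t} refl = centre-idem t

  private
    near : t ∈ₚ v → f ∈ₚ v → ∃[ x ] Avoiding t f x → ∃[ x ] x ∈ D × v ≢ x × Meets v x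
    near {t} t∈v f∈v (x , x∈D , t∈x , f∉x) = x , x∈D , (λ { refl → f∉x f∈v }) , (t , t∈v , t∈x)

  edge-near : ∀ v → ∃[ x ] x ∈ D × v ≢ x × Meets v x
  edge-near v@(r , s , _) with centre r ≟ᶠ s
  ... | no cr≢s  = near first second (edge-avoiding (fst≢snd v) cr≢s)
  ... | yes cr≡s = near second first (edge-avoiding (fst≢snd v ∘ sym) cs≢r)
    where
    cs≢r : centre s ≢ r
    cs≢r cs≡r = fst≢snd v (trans (sym cs≡r) (centre-fixed cr≡s))

  edge-avoiding-leaves : q ≢ c → ∃[ x ] x ∈ D × q ∈ₚ x × (∀ {s} → s ∈ₚ x → s ≡ q ⊎ ¬ LeafOf c s)
  edge-avoiding-leaves {q} {c} q≢c with centre q ≟ᶠ q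
  ... | yes cq≡q with leaf-avoiding cq≡q q
  ...   | ℓ , leaf@(cℓ≡q , _) , _ with leaf-edge leaf
  ...     | x , x∈D , q∈x , _ , only = x , x∈D , q∈x ,
            λ s∈x → [ inj₁ , (λ { refl → inj₂ (q≢c ∘ trans (sym cℓ≡q) ∘ proj₁) }) ]′ (only s∈x)
  edge-avoiding-leaves {q} {c} q≢c | no cq≢q with leaf-edge (refl , cq≢q ∘ sym)
  ... | x , x∈D , _ , q∈x , only = x , x∈D , q∈x ,
        λ s∈x → [ (λ { refl → inj₂ centre-not-leaf }) , inj₁ ]′ (only s∈x)

  private
    separates-at : ∀ {s x} → s ∈ₚ u → s ∈ₚ x → (∀ {r} → r ∈ₚ x → ¬ r ∈ₚ v) → Separates u v x
    separates-at {s = s} s∈u s∈x x∩v=∅ =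
      inj₁ ((s , s∈u , s∈x) , λ (r , r∈v , r∈x) → x∩v=∅ r∈x r∈v)

    leaf-separates : ¬ Meets u v → c ∈ₚ u → LeafOf c ℓ → ¬ ℓ ∈ₚ v → ∃[ x ] x ∈ D × Separates u v x
    leaf-separates {u} {v} {c} ¬uv c∈u leaf ℓ∉v with leaf-edge leaf
    ... | x , x∈D , c∈x , _ , only = x , x∈D , separates-at c∈u c∈x
          λ r∈x r∈v → [ (λ { refl → ¬uv (c , c∈u , r∈v) }) , (λ { refl → ℓ∉v r∈v }) ]′ (only r∈x)

  -- If both leaves of c lie in v, then v consists of leaves of c, and an edge at the other vertex
  -- of u avoids them.
  separating-at-centre : ¬ Meets u v → c ∈ₚ u → centre c ≡ c → ∃[ x ] x ∈ D × Separates u v x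
  separating-at-centre {u} {v} {c} ¬uv c∈u cc≡c with two-leaves c cc≡c
  ... | ℓ₁ , ℓ₂ , ℓ₁≢ℓ₂ , leaf₁ , leaf₂ with ℓ₁ ∈ₚ? v | ℓ₂ ∈ₚ? v
  ...   | no ℓ₁∉v  | _        = leaf-separates ¬uv c∈u leaf₁ ℓ₁∉v
  ...   | yes _    | no ℓ₂∉v  = leaf-separates ¬uv c∈u leaf₂ ℓ₂∉v
  ...   | yes ℓ₁∈v | yes ℓ₂∈v with edge-avoiding-leaves (other-≢ c∈u)
  ...     | x , x∈D , q∈x , not-leaf = x , x∈D , separates-at (other-∈ₚ u c) q∈x
            λ r∈x r∈v → [ (λ { refl → ¬uv (_ , other-∈ₚ u c , r∈v) }) , (λ ¬leaf → ¬leaf (v-leaf r∈v)) ]′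
                          (not-leaf r∈x)
    where
    v-leaf : ∀ {s} → s ∈ₚ v → LeafOf c s
    v-leaf s∈v = [ (λ { refl → leaf₁ }) , (λ { refl → leaf₂ }) ]′ (∈ₚ-two ℓ₁≢ℓ₂ ℓ₁∈v ℓ₂∈v s∈v)

  separating : ¬ Meets u v → ∃[ x ] x ∈ D × Separates u v x
  separating {u@(p , _ , _)} {v} ¬uv with centre p ≟ᶠ p
  ... | yes cp≡p = separating-at-centre ¬uv first cp≡p
  ... | no cp≢p with centre p ∈ₚ? v
  ...   | yes cp∈v with separating-at-centre (¬uv ∘ meets-sym) cp∈v (centre-idem p)
  ...     | x , x∈D , sep = x , x∈D , separates-sym sep
  separating {u@(p , _ , _)} {v} ¬uv | no cp≢p | no cp∉v with leaf-edge (refl , cp≢p ∘ sym)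
  ... | x , x∈D , _ , p∈x , only = x , x∈D , separates-at first p∈x
        λ r∈x r∈v → [ (λ { refl → cp∉v r∈v }) , (λ { refl → ¬uv (p , first , r∈v) }) ]′ (only r∈x)

  module SharedCase {u v : Pair n} {a : Fin n} (u≢v : u ≢ v) (a∈u : a ∈ₚ u) (a∈v : a ∈ₚ v) where

    bᵤ cᵥ : Fin n
    bᵤ = other u a
    cᵥ = other v a

    bᵤ≢cᵥ : bᵤ ≢ cᵥ
    bᵤ≢cᵥ = other-≢-other u≢v a∈u a∈v

    private variable
      x y : Pair n

    δ-bᵤ : Avoiding bᵤ cᵥ x → δ u v x ≡ 2 ⊖ 1 ⊎ δ u v x ≡ 0 ⊖ 2
    δ-bᵤ (_ , bᵤ∈x , cᵥ∉x) = δ-shared-u 5≤n u≢v a∈u a∈v bᵤ∈x cᵥ∉x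

    δ-cᵥ : Avoiding cᵥ bᵤ y → δ u v y ≡ 1 ⊖ 2 ⊎ δ u v y ≡ 2 ⊖ 0
    δ-cᵥ (_ , cᵥ∈y , bᵤ∉y) = δ-shared-v 5≤n u≢v a∈u a∈v cᵥ∈y bᵤ∉y

    δ-both : bᵤ ∈ₚ x → cᵥ ∈ₚ x → δ u v x ≡ 2 ⊖ 2
    δ-both = δ-shared-both 5≤n u≢v a∈u a∈v

    bᵤ-vs-cᵥ : Avoiding bᵤ cᵥ x → Avoiding cᵥ bᵤ y → Resolved D u v
    bᵤ-vs-cᵥ bx@(x∈D , _) cy@(y∈D , _) with δ-bᵤ bx | δ-cᵥ cy
    ... | inj₁ e₁ | inj₁ e₂ = resolved x∈D y∈D e₁ e₂ λ ()
    ... | inj₁ e₁ | inj₂ e₂ = resolved x∈D y∈D e₁ e₂ λ ()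
    ... | inj₂ e₁ | inj₁ e₂ = resolved x∈D y∈D e₁ e₂ λ ()
    ... | inj₂ e₁ | inj₂ e₂ = resolved x∈D y∈D e₁ e₂ λ ()

    both-vs-cᵥ : EdgeBetween cᵥ bᵤ x → Avoiding cᵥ bᵤ y → Resolved D u v
    both-vs-cᵥ (x∈D , cᵥ∈x , bᵤ∈x , _) cy@(y∈D , _) with δ-cᵥ cy
    ... | inj₁ e = resolved x∈D y∈D (δ-both bᵤ∈x cᵥ∈x) e λ ()
    ... | inj₂ e = resolved x∈D y∈D (δ-both bᵤ∈x cᵥ∈x) e λ ()

    bᵤ-vs-both : Avoiding bᵤ cᵥ x → EdgeBetween bᵤ cᵥ y → Resolved D u v
    bᵤ-vs-both bx@(x∈D , _) (y∈D , bᵤ∈y , cᵥ∈y , _) with δ-bᵤ bx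
    ... | inj₁ e = resolved x∈D y∈D e (δ-both bᵤ∈y cᵥ∈y) λ ()
    ... | inj₂ e = resolved x∈D y∈D e (δ-both bᵤ∈y cᵥ∈y) λ ()

    -- If bᵤ hangs on cᵥ or vice versa, the pair {bᵤ, cᵥ} is itself an edge of D, with δ = 0.
    resolve : Resolved D u v
    resolve with centre bᵤ ≟ᶠ cᵥ | centre cᵥ ≟ᶠ bᵤ
    ... | yes cb≡c | _        =
      both-vs-cᵥ (proj₂ (leaf-edge (cb≡c , bᵤ≢cᵥ))) (proj₂ (edge-avoiding (bᵤ≢cᵥ ∘ sym) cc≢b))
      where
      cc≢b : centre cᵥ ≢ bᵤ
      cc≢b cc≡b = bᵤ≢cᵥ (trans (sym cc≡b) (centre-fixed cb≡c))
    ... | no _     | yes cc≡b =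
      bᵤ-vs-both (proj₂ (edge-avoiding bᵤ≢cᵥ cb≢c)) (proj₂ (leaf-edge (cc≡b , bᵤ≢cᵥ ∘ sym)))
      where
      cb≢c : centre bᵤ ≢ cᵥ
      cb≢c cb≡c = bᵤ≢cᵥ (trans (sym (centre-fixed cc≡b)) cb≡c)
    ... | no cb≢c  | no cc≢b  =
      bᵤ-vs-cᵥ (proj₂ (edge-avoiding bᵤ≢cᵥ cb≢c)) (proj₂ (edge-avoiding (bᵤ≢cᵥ ∘ sym) cc≢b))

  resolve-disjoint : ¬ Meets u v → Resolved D u v
  resolve-disjoint {u} {v} ¬uv with separating ¬uv
  ... | z , z∈D , sep with δ-separates 5≤n sep
  ... | inj₁ δz≡1 with edge-near v
  ...   | x , x∈D , v≢x , vx with δ-near-v 5≤n ¬uv v≢x vx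
  ...     | inj₁ e = resolved z∈D x∈D δz≡1 e λ ()
  ...     | inj₂ e = resolved z∈D x∈D δz≡1 e λ ()
  resolve-disjoint {u} {v} ¬uv | z , z∈D , _ | inj₂ δz≡-1 with edge-near u
  ... | y , y∈D , u≢y , uy with δ-near-u 5≤n ¬uv u≢y uy
  ...   | inj₁ e = resolved z∈D y∈D δz≡-1 e λ ()
  ...   | inj₂ e = resolved z∈D y∈D δz≡-1 e λ ()

  doublyResolving : IsDoublyResolving (Kneser2 n) D
  doublyResolving u v u≢v with meets? u v
  ... | yes (_ , a∈u , a∈v) = SharedCase.resolve u≢v a∈u a∈v
  ... | no ¬uv              = resolve-disjoint ¬uv

module Construction {n : ℕ} (3≤n : 3 ≤ n) where

  k : ℕ
  k = n / 3

  instance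
    k-nonZero : NonZero k
    k-nonZero = >-nonZero (/-monoˡ-≤ 3 3≤n)

  3k≤n : k * 3 ≤ n
  3k≤n = m/n*n≤m n 3

  k≤n : k ≤ n
  k≤n = ≤-trans (m≤m*n k 3) 3k≤n

  centre : Fin n → Fin n
  centre i = fromℕ< (<-≤-trans (m%n<n (toℕ i) k) k≤n)

  toℕ-centre : ∀ i → toℕ (centre i) ≡ toℕ i % k
  toℕ-centre i = toℕ-fromℕ< _

  centre-idem : ∀ i → centre (centre i) ≡ centre i
  centre-idem i = toℕ-injective (begin
    toℕ (centre (centre i))  ≡⟨ toℕ-centre (centre i) ⟩
    toℕ (centre i) % k       ≡⟨ cong (_% k) (toℕ-centre i) ⟩
    toℕ i % k % k            ≡⟨ m%n%n≡m%n (toℕ i) k ⟩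
    toℕ i % k                ≡⟨ toℕ-centre i ⟨
    toℕ (centre i)           ∎)
    where open ≡-Reasoning

  centre<k : ∀ i → toℕ (centre i) < k
  centre<k i = subst (_< k) (sym (toℕ-centre i)) (m%n<n (toℕ i) k)

  centre-fixed⇒<k : ∀ {c} → centre c ≡ c → toℕ c < k
  centre-fixed⇒<k {c} cc≡c = subst (_< k) (cong toℕ cc≡c) (centre<k c)

  module _ {c : Fin n} (c<k : toℕ c < k) where

    private
      shift< : ∀ {m} → m ≤ 2 → toℕ c + m * k < n
      shift< {m} m≤2 = begin-strict
        toℕ c + m * k  <⟨ +-monoˡ-< (m * k) c<k ⟩
        k + m * k      ≤⟨ +-monoʳ-≤ k (*-monoˡ-≤ k m≤2) ⟩
        k + 2 * k      ≡⟨ k+2k≡3k k ⟩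
        k * 3          ≤⟨ 3k≤n ⟩
        n              ∎
        where
        open ≤-Reasoning
        k+2k≡3k : ∀ k → k + 2 * k ≡ k * 3
        k+2k≡3k = solve-∀

    shift : ∀ m → m ≤ 2 → Fin n
    shift m m≤2 = fromℕ< (shift< m≤2)

    toℕ-shift : ∀ {m} (m≤2 : m ≤ 2) → toℕ (shift m m≤2) ≡ toℕ c + m * k
    toℕ-shift m≤2 = toℕ-fromℕ< (shift< m≤2)

    centre-shift : ∀ {m} (m≤2 : m ≤ 2) → centre (shift m m≤2) ≡ c
    centre-shift {m} m≤2 = toℕ-injective (begin
      toℕ (centre (shift m m≤2))  ≡⟨ toℕ-centre _ ⟩
      toℕ (shift m m≤2) % k       ≡⟨ cong (_% k) (toℕ-shift m≤2) ⟩
      (toℕ c + m * k) % k         ≡⟨ [m+kn]%n≡m%n (toℕ c) m k ⟩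
      toℕ c % k                   ≡⟨ m<n⇒m%n≡m c<k ⟩
      toℕ c                       ∎)
      where open ≡-Reasoning

    shift-injective : ∀ {m m′} (m≤2 : m ≤ 2) (m′≤2 : m′ ≤ 2) → shift m m≤2 ≡ shift m′ m′≤2 → m ≡ m′
    shift-injective {m} {m′} m≤2 m′≤2 eq = *-cancelʳ-≡ m m′ k (+-cancelˡ-≡ (toℕ c) _ _ (begin
      toℕ c + m * k          ≡⟨ toℕ-shift m≤2 ⟨
      toℕ (shift m m≤2)      ≡⟨ cong toℕ eq ⟩
      toℕ (shift m′ m′≤2)    ≡⟨ toℕ-shift m′≤2 ⟩
      toℕ c + m′ * k         ∎))
      where open ≡-Reasoning

    shift-zero : shift 0 z≤n ≡ c
    shift-zero = toℕ-injective (trans (toℕ-shift z≤n) (+-identityʳ (toℕ c)))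

    shift≢c : ∀ {m} (m≤2 : m ≤ 2) → m ≢ 0 → shift m m≤2 ≢ c
    shift≢c m≤2 m≢0 eq = m≢0 (shift-injective m≤2 z≤n (trans eq (sym shift-zero)))

  two-leaves : ∀ c → centre c ≡ c →
    ∃₂ λ ℓ₁ ℓ₂ → ℓ₁ ≢ ℓ₂ × (centre ℓ₁ ≡ c × ℓ₁ ≢ c) × (centre ℓ₂ ≡ c × ℓ₂ ≢ c)
  two-leaves c cc≡c =
    shift c<k 1 1≤2 , shift c<k 2 ≤-refl , (λ ()) ∘ shift-injective c<k 1≤2 ≤-refl ,
    (centre-shift c<k 1≤2 , shift≢c c<k 1≤2 (λ ())) , (centre-shift c<k ≤-refl , shift≢c c<k ≤-refl (λ ()))
    where
    c<k : toℕ c < k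
    c<k = centre-fixed⇒<k cc≡c
    1≤2 : 1 ≤ 2
    1≤2 = s≤s z≤n

  leaf : Fin (n ∸ k) → Fin n
  leaf j = fromℕ< (subst (k + toℕ j <_) (m+[n∸m]≡n k≤n) (+-monoʳ-< k (toℕ<n j)))

  toℕ-leaf : ∀ j → toℕ (leaf j) ≡ k + toℕ j
  toℕ-leaf j = toℕ-fromℕ< _

  centre≢leaf : ∀ {i} j → centre i ≢ leaf j
  centre≢leaf {i} j ci≡lj =
    <⇒≱ (centre<k i) (subst (k ≤_) (sym (trans (cong toℕ ci≡lj) (toℕ-leaf j))) (m≤m+n k (toℕ j)))

  edge : Fin (n ∸ k) → Pair n
  edge j = pair (centre (leaf j)) (leaf j) (centre≢leaf j)

  D : List (Pair n)
  D = map edge (allFin (n ∸ k))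

  length-D : length D ≡ n ∸ k
  length-D = trans (length-map edge (allFin (n ∸ k))) (length-tabulate (λ j → j))

  edge-injective : ∀ {i j} → edge i ≡ edge j → i ≡ j
  edge-injective {i} {j} eq with ∈ₚ-pair⁻ (centre≢leaf j) (subst (leaf i ∈ₚ_) eq (∈ₚ-pairʳ (centre≢leaf i)))
  ... | inj₁ li≡cj = ⊥-elim (centre≢leaf i (sym li≡cj))
  ... | inj₂ li≡lj = toℕ-injective (+-cancelˡ-≡ k _ _
                       (trans (sym (toℕ-leaf i)) (trans (cong toℕ li≡lj) (toℕ-leaf j))))

  D-unique : Unique D
  D-unique = map⁺ edge-injective (allFin⁺ (n ∸ k))

  joined : ∀ ℓ → centre ℓ ≢ ℓ → ∃[ x ] x ∈ D × centre ℓ ∈ₚ x × ℓ ∈ₚ x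
  joined ℓ cℓ≢ℓ = edge j , ∈-map⁺ edge (∈-allFin j) ,
    subst (λ t → centre t ∈ₚ edge j) leaf-j≡ℓ (∈ₚ-pairˡ (centre≢leaf j)) ,
    subst (_∈ₚ edge j) leaf-j≡ℓ (∈ₚ-pairʳ (centre≢leaf j))
    where
    k≤ℓ : k ≤ toℕ ℓ
    k≤ℓ = ≮⇒≥ λ ℓ<k → cℓ≢ℓ (toℕ-injective (trans (toℕ-centre ℓ) (m<n⇒m%n≡m ℓ<k)))
    j : Fin (n ∸ k)
    j = fromℕ< (∸-monoˡ-< (toℕ<n ℓ) k≤ℓ)
    leaf-j≡ℓ : leaf j ≡ ℓ
    leaf-j≡ℓ = toℕ-injective (trans (toℕ-leaf j) (trans (cong (k +_) (toℕ-fromℕ< _)) (m+[n∸m]≡n k≤ℓ)))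

module _ {n : ℕ} where

  degree : List (Pair n) → Fin n → ℕ
  degree E i = length (filter (i ∈ₚ?_) E)

  degree-∷ : ∀ e E i → degree (e ∷ E) i ≡ 𝟙 (i ∈ₚ? e) + degree E i
  degree-∷ e E i with i ∈ₚ? e
  ... | yes _ = refl
  ... | no  _ = refl

  𝟙-∈ₚ : ∀ i (e : Pair n) → 𝟙 (i ∈ₚ? e) ≡ 𝟙 (i ≟ᶠ fst e) + 𝟙 (i ≟ᶠ snd e)
  𝟙-∈ₚ i e@(a , b , _) with i ≟ᶠ a | i ≟ᶠ b
  ... | yes refl | yes refl = ⊥-elim (fst≢snd e refl)
  ... | yes refl | no _     = refl
  ... | no _     | yes refl = refl
  ... | no _     | no _     = refl

  ∑-∈ₚ : ∀ e (f : Fin n → ℕ) → ∑[ i ∈ allFin n ] (𝟙 (i ∈ₚ? e) * f i) ≡ f (fst e) + f (snd e)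
  ∑-∈ₚ e f = begin
    ∑[ i ∈ allFin n ] (𝟙 (i ∈ₚ? e) * f i)
      ≡⟨ ∑-cong (allFin n) (λ {i} _ → trans (cong (_* f i) (𝟙-∈ₚ i e))
                                            (*-distribʳ-+ (f i) (𝟙 (i ≟ᶠ fst e)) (𝟙 (i ≟ᶠ snd e)))) ⟩
    ∑[ i ∈ allFin n ] (𝟙 (i ≟ᶠ fst e) * f i + 𝟙 (i ≟ᶠ snd e) * f i)
      ≡⟨ ∑-+ (allFin n) _ _ ⟩
    ∑[ i ∈ allFin n ] (𝟙 (i ≟ᶠ fst e) * f i) + ∑[ i ∈ allFin n ] (𝟙 (i ≟ᶠ snd e) * f i)
      ≡⟨ cong₂ _+_ (∑-𝟙≡ _≟ᶠ_ f (allFin⁺ n) (∈-allFin _)) (∑-𝟙≡ _≟ᶠ_ f (allFin⁺ n) (∈-allFin _)) ⟩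
    f (fst e) + f (snd e)
      ∎
    where open ≡-Reasoning

  handshake : ∀ E (f : Fin n → ℕ) →
              ∑[ i ∈ allFin n ] (degree E i * f i) ≡ ∑[ e ∈ E ] (f (fst e) + f (snd e))
  handshake []      f = ∑-const (allFin n) 0
  handshake (e ∷ E) f = begin
    ∑[ i ∈ allFin n ] (degree (e ∷ E) i * f i)
      ≡⟨ ∑-cong (allFin n) (λ {i} _ → trans (cong (_* f i) (degree-∷ e E i))
                                            (*-distribʳ-+ (f i) (𝟙 (i ∈ₚ? e)) (degree E i))) ⟩
    ∑[ i ∈ allFin n ] (𝟙 (i ∈ₚ? e) * f i + degree E i * f i)
      ≡⟨ ∑-+ (allFin n) _ _ ⟩
    ∑[ i ∈ allFin n ] (𝟙 (i ∈ₚ? e) * f i) + ∑[ i ∈ allFin n ] (degree E i * f i)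
      ≡⟨ cong₂ _+_ (∑-∈ₚ e f) (handshake E f) ⟩
    f (fst e) + f (snd e) + ∑[ e ∈ E ] (f (fst e) + f (snd e))
      ∎
    where open ≡-Reasoning

vertex-charge : ∀ m → m * suc (𝟙 (m ≟ 1)) + 2 * 𝟙 (m ≟ 0) ≡ 2 + (m ∸ 2)
vertex-charge 0             = refl
vertex-charge 1             = refl
vertex-charge (suc (suc m)) = trans (+-identityʳ _) (*-identityʳ (suc (suc m)))

edge-charge : ∀ {P Q : Set} (p : Dec P) (q : Dec Q) → ¬ (P × Q) →
              suc (𝟙 p) + suc (𝟙 q) + 𝟙 (¬? p ×-dec ¬? q) ≡ 3
edge-charge (yes p) (yes q) ¬pq = ⊥-elim (¬pq (p , q))
edge-charge (yes _) (no _)  _   = refl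
edge-charge (no _)  (yes _) _   = refl
edge-charge (no _)  (no _)  _   = refl

-- Lower bound

module LowerBound {n : ℕ} (6≤n : 6 ≤ n) (D : List (Pair n)) (D-unique : Unique D)
                  (resolving : IsDoublyResolving (Kneser2 n) D) where

  private variable
    b c h i j w z : Fin n
    e g x : Pair n

  5≤n : 5 ≤ n
  5≤n = ≤-trans (n≤1+n 5) 6≤n

  edgesAt : Fin n → List (Pair n)
  edgesAt i = filter (i ∈ₚ?_) D

  deg : Fin n → ℕ
  deg = degree D

  edgesAt⁺ : x ∈ D → i ∈ₚ x → x ∈ edgesAt i
  edgesAt⁺ {i = i} = ∈-filter⁺ (i ∈ₚ?_)

  edgesAt⁻ : x ∈ edgesAt i → x ∈ D × i ∈ₚ x
  edgesAt⁻ {i = i} = ∈-filter⁻ (i ∈ₚ?_)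

  deg≥1 : x ∈ D → i ∈ₚ x → 1 ≤ deg i
  deg≥1 x∈D i∈x = ∈-length (edgesAt⁺ x∈D i∈x)

  isolated-∉ : deg i ≡ 0 → x ∈ D → ¬ i ∈ₚ x
  isolated-∉ deg≡0 x∈D i∈x = <⇒≢ (deg≥1 x∈D i∈x) (sym deg≡0)

  leaf-unique : deg i ≡ 1 → x ∈ D → e ∈ D → i ∈ₚ x → i ∈ₚ e → x ≡ e
  leaf-unique deg≡1 x∈D e∈D i∈x i∈e = length≡1⇒≡ deg≡1 (edgesAt⁺ x∈D i∈x) (edgesAt⁺ e∈D i∈e)

  equidistant-disjoint : ∀ {u v} → ¬ Meets u x → ¬ Meets v x → d u x ≡ d v x
  equidistant-disjoint ¬ux ¬vx = trans (d-disjoint ¬ux) (sym (d-disjoint ¬vx))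

  equidistant-meets : ∀ {u v} → u ≢ x → v ≢ x → Meets u x → Meets v x → d u x ≡ d v x
  equidistant-meets u≢x v≢x ux vx = trans (d-meets 5≤n u≢x ux) (sym (d-meets 5≤n v≢x vx))

  no-twins : b ≢ c → (∀ {x} → x ∈ D → b ∈ₚ x → c ∈ₚ x) → (∀ {x} → x ∈ D → c ∈ₚ x → b ∈ₚ x) → ⊥
  no-twins {b} {c} b≢c b⇒c c⇒b = ¬equidistant resolving u≢v equidistant
    where
    a : Fin n
    a = proj₁ (fresh (b ∷ c ∷ []) (≤-trans (s≤s (s≤s (s≤s z≤n))) 5≤n))
    a∉ : a ∉ b ∷ c ∷ []
    a∉ = proj₂ (fresh (b ∷ c ∷ []) (≤-trans (s≤s (s≤s (s≤s z≤n))) 5≤n))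
    a≢b : a ≢ b
    a≢b = a∉ ∘ here
    a≢c : a ≢ c
    a≢c = a∉ ∘ there ∘ here
    u v : Pair n
    u = pair a b a≢b
    v = pair a c a≢c
    c∉u : ¬ c ∈ₚ u
    c∉u = [ a≢c ∘ sym , b≢c ∘ sym ]′ ∘ ∈ₚ-pair⁻ a≢b
    b∉v : ¬ b ∈ₚ v
    b∉v = [ a≢b ∘ sym , b≢c ]′ ∘ ∈ₚ-pair⁻ a≢c
    u≢v : u ≢ v
    u≢v u≡v = c∉u (subst (c ∈ₚ_) (sym u≡v) (∈ₚ-pairʳ a≢c))
    equidistant : Equidistant D u v
    equidistant {x} x∈D with b ∈ₚ? x | a ∈ₚ? x
    ... | yes b∈x | _ = equidistant-meets (λ { refl → c∉u c∈x }) (λ { refl → b∉v b∈x })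
                                           (b , ∈ₚ-pairʳ a≢b , b∈x) (c , ∈ₚ-pairʳ a≢c , c∈x)
      where c∈x = b⇒c x∈D b∈x
    ... | no b∉x | yes a∈x =
      equidistant-meets (λ { refl → b∉x (∈ₚ-pairʳ a≢b) }) (λ { refl → b∉x (c⇒b x∈D (∈ₚ-pairʳ a≢c)) })
                        (a , ∈ₚ-pairˡ a≢b , a∈x) (a , ∈ₚ-pairˡ a≢c , a∈x)
    ... | no b∉x | no a∉x  =
      equidistant-disjoint (¬meets-pair a≢b a∉x b∉x) (¬meets-pair a≢c a∉x (b∉x ∘ c⇒b x∈D))

  isolated-unique : deg i ≡ 0 → deg j ≡ 0 → i ≡ j
  isolated-unique {i} {j} iso-i iso-j with i ≟ᶠ j
  ... | yes i≡j = i≡j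
  ... | no i≢j  = ⊥-elim (no-twins i≢j (λ x∈D i∈x → ⊥-elim (isolated-∉ iso-i x∈D i∈x))
                                       (λ x∈D j∈x → ⊥-elim (isolated-∉ iso-j x∈D j∈x)))

  no-K₂ : x ∈ D → b ∈ₚ x → c ∈ₚ x → b ≢ c → deg b ≡ 1 → deg c ≡ 1 → ⊥
  no-K₂ {x} {b} {c} x∈D b∈x c∈x b≢c leaf-b leaf-c = no-twins b≢c
    (λ e∈D b∈e → subst (c ∈ₚ_) (leaf-unique leaf-b x∈D e∈D b∈x b∈e) c∈x)
    (λ e∈D c∈e → subst (b ∈ₚ_) (leaf-unique leaf-c x∈D e∈D c∈x c∈e) b∈x)

  hub-near : deg w ≢ 0 → ∃[ g ] g ∈ D × w ∈ₚ g × ∃[ h ] h ∈ₚ g × 2 ≤ deg h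
  hub-near {w} deg≢0 with nonempty⇒∈ (n≢0⇒n>0 deg≢0)
  ... | g , g∈edgesAt with edgesAt⁻ g∈edgesAt | 2 ≤? deg w
  ...   | g∈D , w∈g | yes 2≤deg = g , g∈D , w∈g , w , w∈g , 2≤deg
  ...   | g∈D , w∈g | no 2≰deg  = g , g∈D , w∈g , other g w , o∈g , ≤∧≢⇒< (deg≥1 g∈D o∈g) (¬leaf-o ∘ sym)
    where
    o∈g : other g w ∈ₚ g
    o∈g = other-∈ₚ g w
    leaf-w : deg w ≡ 1
    leaf-w = ≤-antisym (≮⇒≥ 2≰deg) (n≢0⇒n>0 deg≢0)
    ¬leaf-o : deg (other g w) ≢ 1
    ¬leaf-o = no-K₂ g∈D w∈g o∈g (other-≢ w∈g ∘ sym) leaf-w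

  neighbours : Fin n → List (Fin n)
  neighbours c = map (λ e → other e c) (edgesAt c)

  length-neighbours : ∀ c → length (neighbours c) ≡ deg c
  length-neighbours c = length-map _ (edgesAt c)

  ∈-closedNbhd : g ∈ D → c ∈ₚ g → w ∈ₚ g → w ∈ c ∷ neighbours c
  ∈-closedNbhd {g} {c} g∈D c∈g w∈g with ∈ₚ-other c∈g w∈g
  ... | inj₁ w≡c = here w≡c
  ... | inj₂ refl = there (∈-map⁺ (λ e → other e c) (edgesAt⁺ g∈D c∈g))

  Inner : Pair n → Set
  Inner e = deg (fst e) ≢ 1 × deg (snd e) ≢ 1

  inner? : ∀ e → Dec (Inner e)
  inner? e = ¬? (deg (fst e) ≟ 1) ×-dec ¬? (deg (snd e) ≟ 1)

  inner⁺ : c ∈ₚ e → deg c ≢ 1 → deg (other e c) ≢ 1 → Inner e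
  inner⁺ {c} {e} c∈e ¬leaf-c ¬leaf-o = endpoint (fst∈ₚ e) , endpoint (snd∈ₚ e)
    where
    endpoint : ∀ {s} → s ∈ₚ e → deg s ≢ 1
    endpoint s∈e = [ (λ { refl → ¬leaf-c }) , (λ { refl → ¬leaf-o }) ]′ (∈ₚ-other c∈e s∈e)

  no-cherry : ∀ {e₁ e₂} → deg z ≡ 0 → e₁ ≢ e₂ → e₁ ∈ D → e₂ ∈ D → c ∈ₚ e₁ → c ∈ₚ e₂ →
              (∀ {x} → x ∈ D → c ∈ₚ x → x ≡ e₁ ⊎ x ≡ e₂) →
              deg (other e₁ c) ≡ 1 → deg (other e₂ c) ≡ 1 → ⊥
  no-cherry {z} {c} {e₁} {e₂} iso-z e₁≢e₂ e₁∈D e₂∈D c∈e₁ c∈e₂ at-c leaf₁ leaf₂ =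
    ¬equidistant resolving u≢v equidistant
    where
    x₁ x₂ : Fin n
    x₁ = other e₁ c
    x₂ = other e₂ c
    z∉ : ∀ {x} → x ∈ D → ¬ z ∈ₚ x
    z∉ = isolated-∉ iso-z
    z≢c : z ≢ c
    z≢c refl = z∉ e₁∈D c∈e₁
    x₁≢x₂ : x₁ ≢ x₂
    x₁≢x₂ x₁≡x₂ = e₁≢e₂ (∈ₚ-ext (other-≢ c∈e₁ ∘ sym) c∈e₁ (other-∈ₚ e₁ c) c∈e₂
                                 (subst (_∈ₚ e₂) (sym x₁≡x₂) (other-∈ₚ e₂ c)))
    u v : Pair n
    u = pair z c z≢c
    v = pair x₁ x₂ x₁≢x₂
    u≢v : u ≢ v
    u≢v u≡v = [ (λ { refl → z∉ e₁∈D (other-∈ₚ e₁ c) }) , (λ { refl → z∉ e₂∈D (other-∈ₚ e₂ c) }) ]′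
                (∈ₚ-pair⁻ x₁≢x₂ (subst (z ∈ₚ_) u≡v (∈ₚ-pairˡ z≢c)))
    c∉v : ¬ c ∈ₚ v
    c∉v = [ other-≢ c∈e₁ ∘ sym , other-≢ c∈e₂ ∘ sym ]′ ∘ ∈ₚ-pair⁻ x₁≢x₂
    meets-v : ∀ {x} → x ∈ D → c ∈ₚ x → Meets v x
    meets-v x∈D c∈x with at-c x∈D c∈x
    ... | inj₁ refl = x₁ , ∈ₚ-pairˡ x₁≢x₂ , other-∈ₚ e₁ c
    ... | inj₂ refl = x₂ , ∈ₚ-pairʳ x₁≢x₂ , other-∈ₚ e₂ c
    ¬meets-v : ∀ {x} → x ∈ D → ¬ c ∈ₚ x → ¬ Meets v x
    ¬meets-v x∈D c∉x (s , s∈v , s∈x) with ∈ₚ-pair⁻ x₁≢x₂ s∈v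
    ... | inj₁ refl = c∉x (subst (c ∈ₚ_) (leaf-unique leaf₁ e₁∈D x∈D (other-∈ₚ e₁ c) s∈x) c∈e₁)
    ... | inj₂ refl = c∉x (subst (c ∈ₚ_) (leaf-unique leaf₂ e₂∈D x∈D (other-∈ₚ e₂ c) s∈x) c∈e₂)
    equidistant : Equidistant D u v
    equidistant {x} x∈D with c ∈ₚ? x
    ... | yes c∈x = equidistant-meets (λ { refl → z∉ x∈D (∈ₚ-pairˡ z≢c) }) (λ { refl → c∉v c∈x })
                                       (c , ∈ₚ-pairʳ z≢c , c∈x) (meets-v x∈D c∈x)
    ... | no c∉x  = equidistant-disjoint (¬meets-pair z≢c (z∉ x∈D) c∉x) (¬meets-v x∈D c∉x)

  cherry : deg z ≡ 0 → deg c ≡ 2 → ∃[ e ] e ∈ D × c ∈ₚ e × Inner e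
  cherry {z} {c} iso-z deg≡2 with length≡2⇒ deg≡2 (filter⁺ (c ∈ₚ?_) D-unique)
  ... | e₁ , e₂ , e₁≢e₂ , e₁∈ , e₂∈ , only
    with edgesAt⁻ e₁∈ | edgesAt⁻ e₂∈ | deg (other e₁ c) ≟ 1 | deg (other e₂ c) ≟ 1
  ... | e₁∈D , c∈e₁ | _ | no ¬leaf₁ | _ = e₁ , e₁∈D , c∈e₁ , inner⁺ c∈e₁ ¬leaf-c ¬leaf₁
    where ¬leaf-c = λ deg≡1 → 1+n≢n (trans (sym deg≡2) deg≡1)
  ... | _ | e₂∈D , c∈e₂ | yes _ | no ¬leaf₂ = e₂ , e₂∈D , c∈e₂ , inner⁺ c∈e₂ ¬leaf-c ¬leaf₂
    where ¬leaf-c = λ deg≡1 → 1+n≢n (trans (sym deg≡2) deg≡1)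
  ... | e₁∈D , c∈e₁ | e₂∈D , c∈e₂ | yes leaf₁ | yes leaf₂ =
    ⊥-elim (no-cherry iso-z e₁≢e₂ e₁∈D e₂∈D c∈e₁ c∈e₂ (λ x∈D c∈x → only (edgesAt⁺ x∈D c∈x)) leaf₁ leaf₂)

  -- Leaves count twice, so that an edge at a leaf carries the same charge 2 + 1 as an inner
  -- edge carries as 1 + 1 + 1.
  weight : Fin n → ℕ
  weight i = suc (𝟙 (deg i ≟ 1))

  weighted-degrees excess inner-edges isolated : ℕ
  weighted-degrees = ∑[ i ∈ allFin n ] (deg i * weight i)
  excess           = ∑[ i ∈ allFin n ] (deg i ∸ 2)
  inner-edges      = ∑[ e ∈ D ] 𝟙 (inner? e)
  isolated         = ∑[ i ∈ allFin n ] 𝟙 (deg i ≟ 0)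

  vertex-sum : 2 * n + excess ≡ weighted-degrees + 2 * isolated
  vertex-sum = begin
    2 * n + excess
      ≡⟨ cong (λ m → 2 * m + excess) (length-tabulate {n = n} (λ i → i)) ⟨
    2 * length (allFin n) + excess
      ≡⟨ cong (_+ excess) (∑-const (allFin n) 2) ⟨
    ∑[ i ∈ allFin n ] 2 + excess
      ≡⟨ ∑-+ (allFin n) (λ _ → 2) (λ i → deg i ∸ 2) ⟨
    ∑[ i ∈ allFin n ] (2 + (deg i ∸ 2))
      ≡⟨ ∑-cong (allFin n) (λ {i} _ → vertex-charge (deg i)) ⟨
    ∑[ i ∈ allFin n ] (deg i * weight i + 2 * 𝟙 (deg i ≟ 0))
      ≡⟨ ∑-+ (allFin n) _ _ ⟩
    weighted-degrees + ∑[ i ∈ allFin n ] (2 * 𝟙 (deg i ≟ 0))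
      ≡⟨ cong (weighted-degrees +_) (∑-*ˡ (allFin n) 2 _) ⟩
    weighted-degrees + 2 * isolated
      ∎
    where open ≡-Reasoning

  edge-sum : weighted-degrees + inner-edges ≡ 3 * length D
  edge-sum = begin
    weighted-degrees + inner-edges
      ≡⟨ cong (_+ inner-edges) (handshake D weight) ⟩
    ∑[ e ∈ D ] (weight (fst e) + weight (snd e)) + inner-edges
      ≡⟨ ∑-+ D _ _ ⟨
    ∑[ e ∈ D ] (weight (fst e) + weight (snd e) + 𝟙 (inner? e))
      ≡⟨ ∑-cong D charge ⟩
    ∑[ e ∈ D ] 3
      ≡⟨ ∑-const D 3 ⟩
    3 * length D
      ∎
    where
    open ≡-Reasoning
    charge : ∀ {e} → e ∈ D → weight (fst e) + weight (snd e) + 𝟙 (inner? e) ≡ 3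
    charge {e} e∈D = edge-charge (deg (fst e) ≟ 1) (deg (snd e) ≟ 1)
      λ (leaf₁ , leaf₂) → no-K₂ e∈D (fst∈ₚ e) (snd∈ₚ e) (fst≢snd e) leaf₁ leaf₂

  counting : 2 * n + excess + inner-edges ≡ 3 * length D + 2 * isolated
  counting = begin
    2 * n + excess + inner-edges                   ≡⟨ cong (_+ inner-edges) vertex-sum ⟩
    weighted-degrees + 2 * isolated + inner-edges  ≡⟨ swap-last weighted-degrees (2 * isolated) inner-edges ⟩
    weighted-degrees + inner-edges + 2 * isolated  ≡⟨ cong (_+ 2 * isolated) edge-sum ⟩
    3 * length D + 2 * isolated                    ∎
    where
    open ≡-Reasoning
    swap-last : ∀ a b c → a + b + c ≡ a + c + b
    swap-last a b c = trans (+-assoc a b c) (trans (cong (a +_) (+-comm b c)) (sym (+-assoc a c b)))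

  isolated≡0 : (∀ i → deg i ≢ 0) → isolated ≡ 0
  isolated≡0 none =
    trans (∑-cong (allFin n) (λ {i} _ → 𝟙-reject (deg i ≟ 0) (none i))) (∑-const (allFin n) 0)

  isolated≡1 : deg z ≡ 0 → isolated ≡ 1
  isolated≡1 {z} iso-z =
    trans (∑-cong (allFin n) pointwise) (∑-𝟙≡ _≟ᶠ_ (λ _ → 1) (allFin⁺ n) (∈-allFin z))
    where
    pointwise : ∀ {i} → i ∈ allFin n → 𝟙 (deg i ≟ 0) ≡ 𝟙 (i ≟ᶠ z) * 1
    pointwise {i} _ =
      trans (𝟙-cong (deg i ≟ 0) (i ≟ᶠ z) (λ iso-i → isolated-unique iso-i iso-z) (λ { refl → iso-z }))
            (sym (*-identityʳ _))

  excess-≥ : ∀ c → deg c ∸ 2 ≤ excess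
  excess-≥ c = ∈⇒≤∑ (λ i → deg i ∸ 2) (∈-allFin c)

  inner-≥ : e ∈ D → Inner e → 1 ≤ inner-edges
  inner-≥ {e} e∈D inner =
    subst (_≤ inner-edges) (𝟙-accept (inner? e) inner) (∈⇒≤∑ (λ e → 𝟙 (inner? e)) e∈D)

  slack-deg4 : 4 ≤ deg c → 2 ≤ excess + inner-edges
  slack-deg4 {c} 4≤deg = ≤-trans (∸-monoˡ-≤ 2 4≤deg) (≤-trans (excess-≥ c) (m≤m+n excess inner-edges))

  slack-deg3-deg3 : c ≢ h → 3 ≤ deg c → 3 ≤ deg h → 2 ≤ excess + inner-edges
  slack-deg3-deg3 {c} {h} c≢h 3≤c 3≤h = ≤-trans (+-mono-≤ (∸-monoˡ-≤ 2 3≤c) (∸-monoˡ-≤ 2 3≤h))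
    (≤-trans (∈-∈-≢⇒+≤∑ (λ i → deg i ∸ 2) (∈-allFin c) (∈-allFin h) c≢h) (m≤m+n excess inner-edges))

  slack-deg3-inner : 3 ≤ deg c → e ∈ D → Inner e → 2 ≤ excess + inner-edges
  slack-deg3-inner {c} 3≤c e∈D inner =
    +-mono-≤ (≤-trans (∸-monoˡ-≤ 2 3≤c) (excess-≥ c)) (inner-≥ e∈D inner)

  slack-inner-inner : e ≢ g → e ∈ D → g ∈ D → Inner e → Inner g → 2 ≤ excess + inner-edges
  slack-inner-inner {e} {g} e≢g e∈D g∈D inner-e inner-g = ≤-trans
    (subst₂ (λ p q → p + q ≤ inner-edges) (𝟙-accept (inner? e) inner-e) (𝟙-accept (inner? g) inner-g)
      (∈-∈-≢⇒+≤∑ (λ e → 𝟙 (inner? e)) e∈D g∈D e≢g))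
    (m≤n+m inner-edges excess)

  -- With an isolated vertex, every hub has degree ≥ 3 or lies on an inner edge (by cherry), and
  -- n ≥ 6 leaves room for a second hub away from the first one.
  module _ {z : Fin n} (iso-z : deg z ≡ 0) where

    hub-charged : 2 ≤ deg h → 3 ≤ deg h ⊎ ∃[ e ] e ∈ D × h ∈ₚ e × Inner e
    hub-charged {h} 2≤deg with 3 ≤? deg h
    ... | yes 3≤deg = inj₁ 3≤deg
    ... | no 3≰deg  = inj₂ (cherry iso-z (≤-antisym (≤-pred (≰⇒> 3≰deg)) 2≤deg))

    slack-deg3-hub : 3 ≤ deg c → c ≢ h → 2 ≤ deg h → 2 ≤ excess + inner-edges
    slack-deg3-hub 3≤c c≢h 2≤h with hub-charged 2≤h
    ... | inj₁ 3≤h                 = slack-deg3-deg3 c≢h 3≤c 3≤h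
    ... | inj₂ (_ , e∈D , _ , inner) = slack-deg3-inner 3≤c e∈D inner

    slack-inner-hub : e ∈ D → Inner e → ¬ h ∈ₚ e → 2 ≤ deg h → 2 ≤ excess + inner-edges
    slack-inner-hub e∈D inner-e h∉e 2≤h with hub-charged 2≤h
    ... | inj₁ 3≤h                       = slack-deg3-inner 3≤h e∈D inner-e
    ... | inj₂ (_ , g∈D , h∈g , inner-g) = slack-inner-inner (λ { refl → h∉e h∈g }) e∈D g∈D inner-e inner-g

    non-isolated : w ≢ z → deg w ≢ 0
    non-isolated w≢z iso-w = w≢z (isolated-unique iso-w iso-z)

    -- A hub next to some vertex w ∉ L; it is none of the vertices whose closed neighbourhood lies in L.
    hub-outside : (L : List (Fin n)) → length L < n → z ∈ L →
                  ∃[ h ] 2 ≤ deg h × (∀ {c} → (∀ {s} → s ∈ c ∷ neighbours c → s ∈ L) → h ≢ c)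
    hub-outside L L<n z∈L with fresh L L<n
    ... | w , w∉L with hub-near (non-isolated (λ { refl → w∉L z∈L }))
    ...   | g , g∈D , w∈g , h , h∈g , 2≤h =
      h , 2≤h , λ { N[c]⊆L refl → w∉L (N[c]⊆L (∈-closedNbhd g∈D h∈g w∈g)) }

    private
      ≤5⇒<n : ∀ (L : List (Fin n)) → length L ≤ 5 → length L < n
      ≤5⇒<n _ L≤5 = ≤-trans (s≤s L≤5) 6≤n

      #neighbours≤ : ∀ {c k} → ¬ suc k ≤ deg c → length (neighbours c) ≤ k
      #neighbours≤ {c} k<deg = subst (_≤ _) (sym (length-neighbours c)) (≤-pred (≰⇒> k<deg))

    slack-deg3 : 3 ≤ deg c → 2 ≤ excess + inner-edges
    slack-deg3 {c} 3≤c with 4 ≤? deg c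
    ... | yes 4≤c = slack-deg4 4≤c
    ... | no 4≰c
      with hub-outside (z ∷ c ∷ neighbours c) (≤5⇒<n (z ∷ c ∷ neighbours c) (s≤s (s≤s (#neighbours≤ 4≰c))))
                       (here refl)
    ...   | h , 2≤h , outside = slack-deg3-hub 3≤c (outside there ∘ sym) 2≤h

    slack-short-inner : e ∈ D → h ∈ₚ e → Inner e → ¬ 3 ≤ deg h → ¬ 3 ≤ deg (other e h) →
                        2 ≤ excess + inner-edges
    slack-short-inner {e} {h} e∈D h∈e inner 3≰h 3≰y = conclude (hub-outside L L<n (here refl))
      where
      y : Fin n
      y = other e h
      y∈e : y ∈ₚ e
      y∈e = other-∈ₚ e h
      L : List (Fin n)
      L = z ∷ neighbours h ++ neighbours y
      L<n : length L < n
      L<n = ≤5⇒<n L (s≤s (subst (_≤ 4) (sym (length-++ (neighbours h)))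
                                  (+-mono-≤ (#neighbours≤ 3≰h) (#neighbours≤ 3≰y))))
      N[h]⊆L : ∀ {s} → s ∈ h ∷ neighbours h → s ∈ L
      N[h]⊆L (here refl) with ∈-closedNbhd e∈D y∈e h∈e
      ... | here h≡y   = ⊥-elim (other-≢ h∈e (sym h≡y))
      ... | there h∈Ny = there (∈-++⁺ʳ (neighbours h) h∈Ny)
      N[h]⊆L (there s∈Nh) = there (∈-++⁺ˡ s∈Nh)
      N[y]⊆L : ∀ {s} → s ∈ y ∷ neighbours y → s ∈ L
      N[y]⊆L (here refl) with ∈-closedNbhd e∈D h∈e y∈e
      ... | here y≡h   = ⊥-elim (other-≢ h∈e y≡h)
      ... | there y∈Nh = there (∈-++⁺ˡ y∈Nh)
      N[y]⊆L (there s∈Ny) = there (∈-++⁺ʳ (neighbours h) s∈Ny)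
      conclude : ∃[ h′ ] 2 ≤ deg h′ × (∀ {c} → (∀ {s} → s ∈ c ∷ neighbours c → s ∈ L) → h′ ≢ c) →
                 2 ≤ excess + inner-edges
      conclude (h′ , 2≤h′ , outside) = slack-inner-hub e∈D inner h′∉e 2≤h′
        where
        h′∉e : ¬ h′ ∈ₚ e
        h′∉e h′∈e = [ outside N[h]⊆L , outside N[y]⊆L ]′ (∈ₚ-other h∈e h′∈e)

    slack-inner : e ∈ D → h ∈ₚ e → Inner e → 2 ≤ excess + inner-edges
    slack-inner {e} {h} e∈D h∈e inner with 3 ≤? deg h | 3 ≤? deg (other e h)
    ... | yes 3≤h | _       = slack-deg3-inner 3≤h e∈D inner
    ... | no _    | yes 3≤y = slack-deg3-inner 3≤y e∈D inner
    ... | no 3≰h  | no 3≰y  = slack-short-inner e∈D h∈e inner 3≰h 3≰y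

    slack : 2 ≤ excess + inner-edges
    slack with hub-outside (z ∷ []) (≤5⇒<n (z ∷ []) (s≤s z≤n)) (here refl)
    ... | h , 2≤h , _ with hub-charged 2≤h
    ...   | inj₁ 3≤h                   = slack-deg3 3≤h
    ...   | inj₂ (e , e∈D , h∈e , inner) = slack-inner e∈D h∈e inner

  lower-bound : 2 * n ≤ 3 * length D
  lower-bound with any? (λ i → deg i ≟ 0)
  ... | no none = begin
    2 * n                           ≤⟨ ≤-trans (m≤m+n (2 * n) excess) (m≤m+n _ inner-edges) ⟩
    2 * n + excess + inner-edges    ≡⟨ counting ⟩
    3 * length D + 2 * isolated     ≡⟨ cong (λ k → 3 * length D + 2 * k) (isolated≡0 (λ i → none ∘ (i ,_))) ⟩
    3 * length D + 0                ≡⟨ +-identityʳ _ ⟩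
    3 * length D                    ∎
    where open ≤-Reasoning
  ... | yes (z , iso-z) = +-cancelʳ-≤ 2 (2 * n) (3 * length D) (begin
    2 * n + 2                       ≤⟨ +-monoʳ-≤ (2 * n) (slack iso-z) ⟩
    2 * n + (excess + inner-edges)  ≡⟨ +-assoc (2 * n) excess inner-edges ⟨
    2 * n + excess + inner-edges    ≡⟨ counting ⟩
    3 * length D + 2 * isolated     ≡⟨ cong (λ k → 3 * length D + 2 * k) (isolated≡1 iso-z) ⟩
    3 * length D + 2                ∎)
    where open ≤-Reasoning

[a+q*3]/3 : ∀ a q → (a + q * 3) / 3 ≡ a / 3 + q
[a+q*3]/3 a q = trans (+-distrib-/-∣ʳ a (divides-refl q)) (cong ((a / 3) +_) (m*n/n≡m q 3))

private
  [2r+2]/3 : ∀ {r} → r < 3 → (2 * r + 2) / 3 ≡ r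
  [2r+2]/3 (s≤s z≤n)             = refl
  [2r+2]/3 (s≤s (s≤s z≤n))       = refl
  [2r+2]/3 (s≤s (s≤s (s≤s z≤n))) = refl

  ∸-⌈2/3⌉ : ∀ r q → r < 3 → let m = r + q * 3 in m ∸ m / 3 ≡ ⌈ 2 * m / 3 ⌉
  ∸-⌈2/3⌉ r q r<3 = begin
    (r + q * 3) ∸ (r + q * 3) / 3          ≡⟨ cong ((r + q * 3) ∸_) ([a+q*3]/3 r q) ⟩
    (r + q * 3) ∸ (r / 3 + q)              ≡⟨ cong (λ t → (r + q * 3) ∸ (t + q)) (m<n⇒m/n≡0 r<3) ⟩
    (r + q * 3) ∸ q                        ≡⟨ cong (_∸ q) (regroup r q) ⟩
    (r + 2 * q) + q ∸ q                    ≡⟨ m+n∸n≡m (r + 2 * q) q ⟩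
    r + 2 * q                              ≡⟨ cong (_+ 2 * q) ([2r+2]/3 r<3) ⟨
    (2 * r + 2) / 3 + 2 * q                ≡⟨ [a+q*3]/3 (2 * r + 2) (2 * q) ⟨
    (2 * r + 2 + 2 * q * 3) / 3            ≡⟨ cong (_/ 3) (expand r q) ⟩
    (2 * (r + q * 3) + 2) / 3              ∎
    where
    open ≡-Reasoning
    regroup : ∀ r q → r + q * 3 ≡ (r + 2 * q) + q
    regroup = solve-∀
    expand : ∀ r q → 2 * r + 2 + 2 * q * 3 ≡ 2 * (r + q * 3) + 2
    expand = solve-∀

n∸n/3≡⌈2n/3⌉ : ∀ n → n ∸ n / 3 ≡ ⌈ 2 * n / 3 ⌉
n∸n/3≡⌈2n/3⌉ n = subst (λ m → m ∸ m / 3 ≡ ⌈ 2 * m / 3 ⌉) (sym (m≡m%n+[m/n]*n n 3))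
                        (∸-⌈2/3⌉ (n % 3) (n / 3) (m%n<n n 3))

⌈2n/3⌉-least : ∀ {n m} → 2 * n ≤ 3 * m → ⌈ 2 * n / 3 ⌉ ≤ m
⌈2n/3⌉-least {n} {m} 2n≤3m = begin
  (2 * n + 2) / 3  ≤⟨ /-monoˡ-≤ 3 (+-monoˡ-≤ 2 (≤-trans 2n≤3m (≤-reflexive (*-comm 3 m)))) ⟩
  (m * 3 + 2) / 3  ≡⟨ cong (_/ 3) (+-comm (m * 3) 2) ⟩
  (2 + m * 3) / 3  ≡⟨ [a+q*3]/3 2 m ⟩
  m                ∎
  where open ≤-Reasoning

corollary2 : (n : ℕ) → 6 ≤ n →
    DoublyMetricDimensionIs (Kneser2 n) ⌈ 2 * n / 3 ⌉
corollary2 n 6≤n = (D , D-unique , resolving , |D|≡⌈2n/3⌉) , minimal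
  where
  open Construction (≤-trans (s≤s (s≤s (s≤s z≤n))) 6≤n)
  resolving : IsDoublyResolving (Kneser2 n) D
  resolving = StarForest.doublyResolving (≤-trans (n≤1+n 5) 6≤n) centre centre-idem two-leaves D joined
  |D|≡⌈2n/3⌉ : length D ≡ ⌈ 2 * n / 3 ⌉
  |D|≡⌈2n/3⌉ = trans length-D (n∸n/3≡⌈2n/3⌉ n)
  minimal : ∀ D′ → Unique D′ → IsDoublyResolving (Kneser2 n) D′ → ⌈ 2 * n / 3 ⌉ ≤ length D′
  minimal D′ D′-unique D′-resolving = ⌈2n/3⌉-least {n} (LowerBound.lower-bound 6≤n D′ D′-unique D′-resolving)
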